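{- Suppose $q\ge3$. In the André/Bruck-Bose setting of the context, a point set $\mathcal{S}$ of $\ell\cong\mathrm{PG}(1,q^t)$ is an $\mathbb{F}_q$-linear club of rank $k$ with head $P_\infty$ if and only if $\phi(\mathcal{S}\setminus\{P_\infty\})$ is an affine $(k-1)$-space of $\Pi$ (the set of points not in $\pi_\infty$ of a $(k-1)$-dimensional subspace of $\Pi$ not contained in $\pi_\infty$).
   Context: Let $q$ be a prime power, $t\ge2$, $k\ge2$. Field reduction: viewing $\mathbb{F}_{q^t}^r$ as $\mathbb{F}_q^{rt}$, points of $\mathrm{PG}(r-1,q^t)$ correspond to $(t-1)$-spaces of $\mathrm{PG}(rt-1,q)$, $(m-1)$-spaces to $(mt-1)$-spaces; $\mathcal{F}(X)$ denotes the image. Images of the points of a line form a Desarguesian $(t-1)$-spread $\mathcal{D}$ of a $(2t-1)$-space. $\mathcal{B}(\pi)$ is the set of elements of $\mathcal{D}$ meeting a subspace $\pi$; an $\mathbb{F}_q$-linear set of rank $k$ on a line is a set $L_\pi$ of points with $\mathcal{F}(L_\pi)=\mathcal{B}(\pi)$, $\pi$ a $(k-1)$-space; the weight of $X\in L_\pi$ is $\dim(\mathcal{F}(X)\cap\pi)+1$; a club of rank $k$ has one point (the head) of weight $k-1$ and all others of weight $1$. ABB setting: in $\mathrm{PG}(2,q^t)$ fix a line $\ell_\infty$, $H_\infty=\mathcal{F}(\ell_\infty)$, fix a $2t$-space $\mu\supset H_\infty$ in $\mathrm{PG}(3t-1,q)$; for a point $P\notin\ell_\infty$ set $\phi(P)=\mathcal{F}(P)\cap\mu$.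 Let $\ell\neq\ell_\infty$ be a line, $P_\infty=\ell\cap\ell_\infty$, $\pi_\infty=\mathcal{F}(P_\infty)$ and $\Pi=\mathcal{F}(\ell)\cap\mu$, a $t$-space containing $\pi_\infty$ and all $\phi(P)$ for $P\in\ell\setminus\{P_\infty\}$. -}

module Defs where

open import Data.Nat using (ℕ; zero; suc; _∸_)
open import Data.Fin using (Fin)
open import Data.Vec using (Vec; replicate; zipWith; map)
open import Data.Product using (Σ; _×_; _,_)
open import Data.Empty using (⊥)
open import Relation.Nullary using (¬_)
open import Relation.Binary.PropositionalEquality using (_≡_; _≢_)
open import Function.Bundles using (_⇔_)
open import Algebra.Structures using (IsCommutativeRing)

record Field : Set₁ where
  infixl 6 _+_
  infixl 7 _*_
  field
    Carrier : Set
    _+_ _*_ : Carrier → Carrier → Carrier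
    -_      : Carrier → Carrier
    0# 1#   : Carrier
    isCommutativeRing : IsCommutativeRing _≡_ _+_ _*_ -_ 0# 1#
    0≢1     : 0# ≢ 1#
    inverse : ∀ x → x ≢ 0# → Σ Carrier (λ y → x * y ≡ 1#)

record Embedding (F E : Field) : Set where
  private
    module F = Field F
    module E = Field E
  field
    ι        : F.Carrier → E.Carrier
    ι-+      : ∀ a b → ι (a F.+ b) ≡ ι a E.+ ι b
    ι-*      : ∀ a b → ι (a F.* b) ≡ ι a E.* ι b
    ι-1      : ι F.1# ≡ E.1#
    ι-inj    : ∀ a b → ι a ≡ ι b → a ≡ b

-- Linear algebra in E^n, over scalars from a type A acting through s : A → E
-- (s = identity: E-linear algebra; s = ι: F-linear algebra, i.e. field reduction).
module LinAlg (E : Field) (n : ℕ) where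
  open Field E

  V : Set
  V = Vec Carrier n

  0v : V
  0v = replicate n 0#

  _⊕_ : V → V → V
  _⊕_ = zipWith _+_

  _·_ : Carrier → V → V
  a · v = map (a *_) v

  sumV : ∀ {d} → (Fin d → V) → V
  sumV {zero}  f = 0v
  sumV {suc d} f = f Fin.zero ⊕ sumV (λ i → f (Fin.suc i))

  lincomb : ∀ {A : Set} {d} → (A → Carrier) → (Fin d → A) → (Fin d → V) → V
  lincomb s c b = sumV (λ i → s (c i) · b i)

  record IsSubspace {A : Set} (s : A → Carrier) (U : V → Set) : Set where
    field
      0∈ : U 0v
      +∈ : ∀ {u v} → U u → U v → U (u ⊕ v)
      ·∈ : ∀ a {u} → U u → U (s a · u)

  record HasDim {A : Set} (s : A → Carrier) (U : V → Set) (d : ℕ) : Set where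
    field
      basis : Fin d → V
      inU   : ∀ i → U (basis i)
      indep : ∀ c → lincomb s c basis ≡ 0v → ∀ i → s (c i) ≡ 0#
      spans : ∀ {u} → U u → Σ (Fin d → A) (λ c → lincomb s c basis ≡ u)

-- The André/Bruck-Bose setting: PG(2,q^t) = projective space of E^3,
-- PG(3t-1,q) = projective space of E^3 viewed as an F-vector space.
-- Subspaces / point sets are represented by their sets of vectors.
module Setting (F E : Field) (emb : Embedding F E) where
  open Field E
  open Embedding emb
  open LinAlg E 3 public

  idE : Carrier → Carrier
  idE a = a

  IsESubspace IsFSubspace : (V → Set) → Set
  IsESubspace = IsSubspace idE
  IsFSubspace = IsSubspace ι

  HasDimE HasDimF : (V → Set) → ℕ → Set
  HasDimE = HasDim idE
  HasDimF = HasDim ι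

  IsLine : (V → Set) → Set
  IsLine U = IsESubspace U × HasDimE U 2

  nonzero : V → Set
  nonzero v = v ≢ 0v

  -- u lies in F(⟨w⟩_E), the field-reduced image of the point ⟨w⟩_E
  InF : V → V → Set
  InF w u = Σ Carrier (λ a → u ≡ a · w)

  -- S is a set of points of the line ℓ (as a set of nonzero vectors closed
  -- under nonzero E-scalars)
  PointSetOn : (V → Set) → (V → Set) → Set
  PointSetOn ℓ S =
    (∀ w → S w → nonzero w × ℓ w) × (∀ a w → a ≢ 0# → S w → S (a · w))

  -- P∞ = ℓ ∩ ℓ∞, π∞ = F(P∞), Π = F(ℓ) ∩ μ
  P∞ : (V → Set) → (V → Set) → V → Set
  P∞ ℓ ℓ∞ v = ℓ v × ℓ∞ v

  π∞ : (V → Set) → (V → Set) → V → Set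
  π∞ = P∞

  Π : (V → Set) → (V → Set) → V → Set
  Π ℓ μ v = ℓ v × μ v

  IsLinearSetOf : (V → Set) → (V → Set) → (V → Set) → Set
  IsLinearSetOf ℓ π S =
    ∀ w → S w ⇔ (nonzero w × ℓ w × Σ V (λ u → nonzero u × π u × InF w u))

  HasWeight : (V → Set) → V → ℕ → Set
  HasWeight π w m = HasDimF (λ u → InF w u × π u) m

  -- S is an F_q-linear club of rank k (π of vector F-dimension k) with head H
  IsLinearClub : (V → Set) → (V → Set) → (V → Set) → ℕ → Set₁
  IsLinearClub ℓ H S k =
    Σ (V → Set) (λ π →
      IsFSubspace π × HasDimF π k × (∀ u → π u → ℓ u) × IsLinearSetOf ℓ π S ×
      (∀ w → S w → (H w → HasWeight π w (k ∸ 1)) × (¬ H w → HasWeight π w 1)))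

  φ : (V → Set) → V → V → Set
  φ μ w v = InF w v × μ v

  PhiImage : (V → Set) → (V → Set) → (V → Set) → (V → Set) → V → Set
  PhiImage ℓ ℓ∞ μ S v =
    nonzero v × Σ V (λ w → S w × ¬ P∞ ℓ ℓ∞ w × φ μ w v)

  -- A is (the set of nonzero vectors of) an affine (k-1)-space of Π w.r.t. π∞:
  -- the points not in π∞ of a k-dim F-subspace W ⊆ Π with W ⊄ π∞
  IsAffineSubspace : (V → Set) → (V → Set) → ℕ → (V → Set) → Set₁
  IsAffineSubspace Πs π∞s k A =
    Σ (V → Set) (λ W →
      IsFSubspace W × HasDimF W k × (∀ v → W v → Πs v) ×
      ¬ (∀ v → W v → π∞s v) × (∀ v → A v ⇔ (W v × ¬ π∞s v)))

-- Field reduction makes E³ an F-space in which ℓ∞ has dimension 2t and μ ⊇ ℓ∞ has dimension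
-- 2t + 1. Hence for w ∉ ℓ∞ the subspace μ meets E·w = F(⟨w⟩) in exactly an F-line φ(⟨w⟩): in at
-- least one, because μ ⊄ ℓ∞ and E³ = ℓ∞ ⊕ E·w, and in at most one, since otherwise μ would contain
-- 2t + 2 independent vectors. Moreover π∞ = ℓ ∩ ℓ∞ = E·p∞ for a single vector p∞.
-- If π is a club with head P∞, then π ∩ π∞ has codimension one in π, so π = F·u ⊕ (π ∩ π∞) for
-- some u ∉ π∞. Scaling by the ρ with ρu ∈ μ moves π into Π = ℓ ∩ μ, and ρπ ∖ π∞ consists exactly
-- of the points φ(P), P ∈ S ∖ {P∞}. Conversely, an affine subspace W of Π serves itself as π:
-- ℓ = E·u ⊕ π∞ with the coefficient along u of every vector of W ⊆ μ forced into F, so W ∩ π∞ is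
-- a hyperplane of W (the weight of the head), while every other point P of S meets W in φ(P).

module Submission where

open import Defs
open import Data.Nat as ℕ using (ℕ; zero; suc; _<_; _≤_; _≤?_; _^_; s≤s)
import Data.Nat.Properties as ℕₚ
open import Data.Fin using (Fin; punchIn; _↑ˡ_; _↑ʳ_; combine; funToFin; finToFun; quotient; remainder)
import Data.Fin as Fin
import Data.Fin.Properties as Fin
open import Data.Vec using (Vec)
open import Data.Vec.Properties using (≡-dec)
import Data.Vec.Functional as Vector
open import Data.Product using (Σ; ∃; _×_; _,_; proj₁; proj₂)
open import Data.Sum using (_⊎_; inj₁; inj₂)
open import Data.Unit using (⊤; tt)
open import Data.Empty using (⊥-elim)
open import Function using (_∘_; _↔_; _⇔_; mk⇔; Equivalence; Inverse)
open import Function.Bundles using (Injection)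
open import Function.Properties.Inverse using (↔⇒↣; ↔-sym)
open import Relation.Nullary using (¬_; Dec; yes; no; ¬?)
open import Relation.Nullary.Decidable using (map′; decidable-stable)
open import Relation.Unary using (Decidable)
open import Relation.Binary.Definitions using (DecidableEquality)
open import Relation.Binary.PropositionalEquality
open import Algebra.Bundles using (CommutativeRing; AbelianGroup)
open import Algebra.Structures using (IsAbelianGroup)
import Algebra.Properties.Ring as RingProperties
import Algebra.Properties.AbelianGroup as AbelianGroupProperties
import Algebra.Properties.CommutativeSemigroup as CommutativeSemigroupProperties
import Algebra.Definitions.RawMonoid as RawMonoidDefinitions

module FieldProperties (K : Field) where
  open Field K public

  commutativeRing : CommutativeRing _ _
  commutativeRing = record { isCommutativeRing = isCommutativeRing }

  open CommutativeRing commutativeRing public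
    using (+-assoc; +-comm; +-identityˡ; +-identityʳ; -‿inverseʳ;
           *-assoc; *-comm; *-identityˡ; *-identityʳ; distribˡ; distribʳ; zeroˡ; zeroʳ)
  open RingProperties (CommutativeRing.ring commutativeRing) public
    using (-‿distribˡ-*; -1*x≈-x; +-inverseʳ-unique; x+x≈x⇒x≈0; x∙y⁻¹≈ε⇒x≈y)

  1≢0 : 1# ≢ 0#
  1≢0 1≡0 = 0≢1 (sym 1≡0)

  infix 25 _⁻¹⟨_⟩
  _⁻¹⟨_⟩ : (x : Carrier) → x ≢ 0# → Carrier
  x ⁻¹⟨ x≢0 ⟩ = proj₁ (inverse x x≢0)

  ⁻¹-inverseʳ : ∀ x (x≢0 : x ≢ 0#) → x * x ⁻¹⟨ x≢0 ⟩ ≡ 1#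
  ⁻¹-inverseʳ x x≢0 = proj₂ (inverse x x≢0)

  ⁻¹-inverseˡ : ∀ x (x≢0 : x ≢ 0#) → x ⁻¹⟨ x≢0 ⟩ * x ≡ 1#
  ⁻¹-inverseˡ x x≢0 = trans (*-comm _ x) (⁻¹-inverseʳ x x≢0)

  ⁻¹-cancelˡ : ∀ x (x≢0 : x ≢ 0#) y → x ⁻¹⟨ x≢0 ⟩ * (x * y) ≡ y
  ⁻¹-cancelˡ x x≢0 y = begin
    x ⁻¹⟨ x≢0 ⟩ * (x * y)  ≡⟨ *-assoc _ x y ⟨
    x ⁻¹⟨ x≢0 ⟩ * x * y    ≡⟨ cong (_* y) (⁻¹-inverseˡ x x≢0) ⟩
    1# * y                 ≡⟨ *-identityˡ y ⟩
    y                      ∎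
    where open ≡-Reasoning

  x*y≡0⇒y≡0 : ∀ {x y} → x ≢ 0# → x * y ≡ 0# → y ≡ 0#
  x*y≡0⇒y≡0 {x} {y} x≢0 xy≡0 =
    trans (sym (⁻¹-cancelˡ x x≢0 y)) (trans (cong (x ⁻¹⟨ x≢0 ⟩ *_) xy≡0) (zeroʳ _))

  x+[-x/y]*y≡0 : ∀ x y (y≢0 : y ≢ 0#) → x + (- (x * y ⁻¹⟨ y≢0 ⟩)) * y ≡ 0#
  x+[-x/y]*y≡0 x y y≢0 = begin
    x + (- (x * y ⁻¹⟨ y≢0 ⟩)) * y  ≡⟨ cong (x +_) (-‿distribˡ-* _ y) ⟨
    x + - (x * y ⁻¹⟨ y≢0 ⟩ * y)    ≡⟨ cong (λ z → x + - z) (*-assoc x _ y) ⟩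
    x + - (x * (y ⁻¹⟨ y≢0 ⟩ * y))  ≡⟨ cong (λ z → x + - (x * z)) (⁻¹-inverseˡ y y≢0) ⟩
    x + - (x * 1#)                 ≡⟨ cong (λ z → x + - z) (*-identityʳ x) ⟩
    x + - x                        ≡⟨ -‿inverseʳ x ⟩
    0#                             ∎
    where open ≡-Reasoning

  x*y≢0 : ∀ {x y} → x ≢ 0# → y ≢ 0# → x * y ≢ 0#
  x*y≢0 x≢0 y≢0 xy≡0 = y≢0 (x*y≡0⇒y≡0 x≢0 xy≡0)

  ⁻¹≢0 : ∀ x (x≢0 : x ≢ 0#) → x ⁻¹⟨ x≢0 ⟩ ≢ 0#
  ⁻¹≢0 x x≢0 x⁻¹≡0 = 1≢0 (trans (sym (⁻¹-inverseʳ x x≢0)) (trans (cong (x *_) x⁻¹≡0) (zeroʳ x)))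

module Vectors (E : Field) where
  open import Data.Vec using ([]; _∷_; replicate)
  open import Data.Vec.Properties using (zipWith-assoc; zipWith-comm; zipWith-identityˡ; zipWith-identityʳ; map-replicate)
  open FieldProperties E
  private open module LinAlgₙ {n} = LinAlg E n

  ⊕-assoc : ∀ {n} (u v w : Vec Carrier n) → (u ⊕ v) ⊕ w ≡ u ⊕ (v ⊕ w)
  ⊕-assoc = zipWith-assoc +-assoc

  ⊕-comm : ∀ {n} (u v : Vec Carrier n) → u ⊕ v ≡ v ⊕ u
  ⊕-comm = zipWith-comm +-comm

  ⊕-identityˡ : ∀ {n} (v : Vec Carrier n) → 0v ⊕ v ≡ v
  ⊕-identityˡ = zipWith-identityˡ +-identityˡ

  ⊕-identityʳ : ∀ {n} (v : Vec Carrier n) → v ⊕ 0v ≡ v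
  ⊕-identityʳ = zipWith-identityʳ +-identityʳ

  ·-distribˡ : ∀ {n} a (u v : Vec Carrier n) → a · (u ⊕ v) ≡ (a · u) ⊕ (a · v)
  ·-distribˡ a []      []      = refl
  ·-distribˡ a (x ∷ u) (y ∷ v) = cong₂ _∷_ (distribˡ a x y) (·-distribˡ a u v)

  ·-distribʳ : ∀ {n} a b (v : Vec Carrier n) → (a + b) · v ≡ (a · v) ⊕ (b · v)
  ·-distribʳ a b []      = refl
  ·-distribʳ a b (x ∷ v) = cong₂ _∷_ (distribʳ x a b) (·-distribʳ a b v)

  ·-assoc : ∀ {n} a b (v : Vec Carrier n) → (a * b) · v ≡ a · (b · v)
  ·-assoc a b []      = refl
  ·-assoc a b (x ∷ v) = cong₂ _∷_ (*-assoc a b x) (·-assoc a b v)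

  ·-identityˡ : ∀ {n} (v : Vec Carrier n) → 1# · v ≡ v
  ·-identityˡ []      = refl
  ·-identityˡ (x ∷ v) = cong₂ _∷_ (*-identityˡ x) (·-identityˡ v)

  ·-zeroˡ : ∀ {n} (v : Vec Carrier n) → 0# · v ≡ 0v
  ·-zeroˡ []      = refl
  ·-zeroˡ (x ∷ v) = cong₂ _∷_ (zeroˡ x) (·-zeroˡ v)

  ·-zeroʳ : ∀ {n} a → a · 0v {n} ≡ 0v
  ·-zeroʳ {n} a = trans (map-replicate (a *_) 0# n) (cong (replicate n) (zeroʳ a))

  ·-comm : ∀ {n} a b (v : Vec Carrier n) → a · (b · v) ≡ b · (a · v)
  ·-comm a b v = begin
    a · (b · v)  ≡⟨ ·-assoc a b v ⟨
    (a * b) · v  ≡⟨ cong (_· v) (*-comm a b) ⟩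
    (b * a) · v  ≡⟨ ·-assoc b a v ⟩
    b · (a · v)  ∎
    where open ≡-Reasoning

  ⊖_ : ∀ {n} → Vec Carrier n → Vec Carrier n
  ⊖ v = (- 1#) · v

  ⊕-inverseʳ : ∀ {n} (v : Vec Carrier n) → v ⊕ (⊖ v) ≡ 0v
  ⊕-inverseʳ v = begin
    v ⊕ (⊖ v)               ≡⟨ cong (_⊕ (⊖ v)) (·-identityˡ v) ⟨
    (1# · v) ⊕ ((- 1#) · v) ≡⟨ ·-distribʳ 1# (- 1#) v ⟨
    (1# + - 1#) · v         ≡⟨ cong (_· v) (-‿inverseʳ 1#) ⟩
    0# · v                  ≡⟨ ·-zeroˡ v ⟩
    0v                      ∎
    where open ≡-Reasoning

  -·-⊖ : ∀ {n} a (v : Vec Carrier n) → (- a) · v ≡ ⊖ (a · v)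
  -·-⊖ a v = trans (cong (_· v) (sym (-1*x≈-x a))) (·-assoc (- 1#) a v)

  ⊕-isAbelianGroup : ∀ {n} → IsAbelianGroup _≡_ _⊕_ (0v {n}) ⊖_
  ⊕-isAbelianGroup = record
    { isGroup = record
      { isMonoid = record
        { isSemigroup = record { isMagma = record { isEquivalence = isEquivalence ; ∙-cong = cong₂ _⊕_ }
                               ; assoc = ⊕-assoc }
        ; identity = ⊕-identityˡ , ⊕-identityʳ }
      ; inverse = (λ v → trans (⊕-comm _ v) (⊕-inverseʳ v)) , ⊕-inverseʳ
      ; ⁻¹-cong = cong ⊖_ }
    ; comm = ⊕-comm }

  ⊕-abelianGroup : ℕ → AbelianGroup _ _
  ⊕-abelianGroup n = record { isAbelianGroup = ⊕-isAbelianGroup {n} }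

  module _ {n : ℕ} where
    open AbelianGroupProperties (⊕-abelianGroup n) public
      using () renaming (inverseʳ-unique to ⊕-inverseʳ-unique; x≈z//y to x⊕y≡z⇒x≡z⊖y)
    open CommutativeSemigroupProperties (AbelianGroup.commutativeSemigroup (⊕-abelianGroup n)) public
      using () renaming (interchange to ⊕-interchange)

  ·-cancelˡ : ∀ {n} a (a≢0 : a ≢ 0#) (v : Vec Carrier n) → a ⁻¹⟨ a≢0 ⟩ · (a · v) ≡ v
  ·-cancelˡ a a≢0 v = begin
    a ⁻¹⟨ a≢0 ⟩ · (a · v)  ≡⟨ ·-assoc _ a v ⟨
    (a ⁻¹⟨ a≢0 ⟩ * a) · v  ≡⟨ cong (_· v) (⁻¹-inverseˡ a a≢0) ⟩
    1# · v                 ≡⟨ ·-identityˡ v ⟩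
    v                      ∎
    where open ≡-Reasoning

  ·-cancelʳ : ∀ {n} a (a≢0 : a ≢ 0#) (v : Vec Carrier n) → a · (a ⁻¹⟨ a≢0 ⟩ · v) ≡ v
  ·-cancelʳ a a≢0 v = begin
    a · (a ⁻¹⟨ a≢0 ⟩ · v)  ≡⟨ ·-assoc a _ v ⟨
    (a * a ⁻¹⟨ a≢0 ⟩) · v  ≡⟨ cong (_· v) (⁻¹-inverseʳ a a≢0) ⟩
    1# · v                 ≡⟨ ·-identityˡ v ⟩
    v                      ∎
    where open ≡-Reasoning

  a·v≡0⇒v≡0 : ∀ {n a} {v : Vec Carrier n} → a ≢ 0# → a · v ≡ 0v → v ≡ 0v
  a·v≡0⇒v≡0 {a = a} {v} a≢0 av≡0 = trans (sym (·-cancelˡ a a≢0 v)) (trans (cong (_ ·_) av≡0) (·-zeroʳ _))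

  a·v≢0 : ∀ {n a} {v : Vec Carrier n} → a ≢ 0# → v ≢ 0v → a · v ≢ 0v
  a·v≢0 a≢0 v≢0 av≡0 = v≢0 (a·v≡0⇒v≡0 a≢0 av≡0)

  ⊕-collect : ∀ {n} a b k (u x y : Vec Carrier n) →
              ((a · u) ⊕ x) ⊕ (k · ((b · u) ⊕ y)) ≡ ((a + k * b) · u) ⊕ (x ⊕ (k · y))
  ⊕-collect a b k u x y = begin
    ((a · u) ⊕ x) ⊕ (k · ((b · u) ⊕ y))         ≡⟨ cong (((a · u) ⊕ x) ⊕_) (·-distribˡ k (b · u) y) ⟩
    ((a · u) ⊕ x) ⊕ ((k · (b · u)) ⊕ (k · y))   ≡⟨ ⊕-interchange (a · u) x (k · (b · u)) (k · y) ⟩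
    ((a · u) ⊕ (k · (b · u))) ⊕ (x ⊕ (k · y))   ≡⟨ cong (λ v → ((a · u) ⊕ v) ⊕ (x ⊕ (k · y))) (·-assoc k b u) ⟨
    ((a · u) ⊕ ((k * b) · u)) ⊕ (x ⊕ (k · y))   ≡⟨ cong (_⊕ (x ⊕ (k · y))) (·-distribʳ a (k * b) u) ⟨
    ((a + k * b) · u) ⊕ (x ⊕ (k · y))           ∎
    where open ≡-Reasoning

idEmbedding : (E : Field) → Embedding E E
idEmbedding E = record
  { ι = λ a → a ; ι-+ = λ _ _ → refl ; ι-* = λ _ _ → refl ; ι-1 = refl ; ι-inj = λ _ _ e → e }

module _ {E : Field} {n : ℕ} {A : Set} {s : A → Field.Carrier E} where
  open LinAlg E n

  ∩-IsSubspace : ∀ {U W : V → Set} → IsSubspace s U → IsSubspace s W → IsSubspace s (λ v → U v × W v)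
  ∩-IsSubspace U-sub W-sub = record
    { 0∈ = U.0∈ , W.0∈
    ; +∈ = λ (u∈U , u∈W) (v∈U , v∈W) → U.+∈ u∈U v∈U , W.+∈ u∈W v∈W
    ; ·∈ = λ a (v∈U , v∈W) → U.·∈ a v∈U , W.·∈ a v∈W
    }
    where
    module U = IsSubspace U-sub
    module W = IsSubspace W-sub

  HasDim-⇔ : ∀ {U W : V → Set} {d} → (∀ v → U v ⇔ W v) → HasDim s U d → HasDim s W d
  HasDim-⇔ U⇔W U-dim = record
    { basis = basis
    ; inU   = λ i → Equivalence.to (U⇔W _) (inU i)
    ; indep = indep
    ; spans = λ v∈W → spans (Equivalence.from (U⇔W _) v∈W)
    }
    where open HasDim U-dim

module Combinations (K E : Field) (emb : Embedding K E) where
  open import Data.Vec.Functional using ([]; _∷_; _++_; insertAt)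
  open import Data.Vec.Functional.Properties using (insertAt-lookup; insertAt-punchIn; lookup-++ˡ; lookup-++ʳ)
  private module K = FieldProperties K
  open FieldProperties E
  open Vectors E
  open Embedding emb public
  private open module LinAlgₙ {n} = LinAlg E n
  open RawMonoidDefinitions (CommutativeRing.+-rawMonoid K.commutativeRing) using (sum)
  open ≡-Reasoning

  ι-0 : ι K.0# ≡ 0#
  ι-0 = x+x≈x⇒x≈0 (ι K.0#) (trans (sym (ι-+ K.0# K.0#)) (cong ι (K.+-identityʳ K.0#)))

  ι-neg : ∀ a → ι (K.- a) ≡ - ι a
  ι-neg a = +-inverseʳ-unique (ι a) (ι (K.- a))
    (trans (sym (ι-+ a (K.- a))) (trans (cong ι (K.-‿inverseʳ a)) ι-0))

  ι≡0⇒≡0 : ∀ {a} → ι a ≡ 0# → a ≡ K.0#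
  ι≡0⇒≡0 {a} ιa≡0 = ι-inj a K.0# (trans ιa≡0 (sym ι-0))

  ι-⁻¹ : ∀ a (a≢0 : a ≢ K.0#) → ι (a K.⁻¹⟨ a≢0 ⟩) * ι a ≡ 1#
  ι-⁻¹ a a≢0 = trans (sym (ι-* _ a)) (trans (cong ι (K.⁻¹-inverseˡ a a≢0)) ι-1)

  ι0·v≡0 : ∀ {n} (v : Vec Carrier n) → ι K.0# · v ≡ 0v
  ι0·v≡0 v = trans (cong (_· v) ι-0) (·-zeroˡ v)

  sumV-cong : ∀ {n d} {f g : Fin d → Vec Carrier n} → (∀ i → f i ≡ g i) → sumV f ≡ sumV g
  sumV-cong {d = zero}  f≗g = refl
  sumV-cong {d = suc d} f≗g = cong₂ _⊕_ (f≗g Fin.zero) (sumV-cong (f≗g ∘ Fin.suc))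

  sumV-zero : ∀ {n d} (f : Fin d → Vec Carrier n) → (∀ i → f i ≡ 0v) → sumV f ≡ 0v
  sumV-zero {d = zero}  f f≗0 = refl
  sumV-zero {d = suc d} f f≗0 =
    trans (cong₂ _⊕_ (f≗0 Fin.zero) (sumV-zero (f ∘ Fin.suc) (f≗0 ∘ Fin.suc))) (⊕-identityˡ 0v)

  sumV-⊕ : ∀ {n d} (f g : Fin d → Vec Carrier n) → sumV (λ i → f i ⊕ g i) ≡ sumV f ⊕ sumV g
  sumV-⊕ {d = zero}  f g = sym (⊕-identityˡ 0v)
  sumV-⊕ {d = suc d} f g =
    trans (cong ((f Fin.zero ⊕ g Fin.zero) ⊕_) (sumV-⊕ (f ∘ Fin.suc) (g ∘ Fin.suc)))
          (⊕-interchange (f Fin.zero) (g Fin.zero) (sumV (f ∘ Fin.suc)) (sumV (g ∘ Fin.suc)))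

  sumV-· : ∀ {n d} a (f : Fin d → Vec Carrier n) → a · sumV f ≡ sumV (λ i → a · f i)
  sumV-· {d = zero}  a f = ·-zeroʳ a
  sumV-· {d = suc d} a f = trans (·-distribˡ a _ _) (cong ((a · f Fin.zero) ⊕_) (sumV-· a (f ∘ Fin.suc)))

  sumV-ι· : ∀ {n d} (c : Fin d → K.Carrier) (v : Vec Carrier n) → sumV (λ i → ι (c i) · v) ≡ ι (sum c) · v
  sumV-ι· {d = zero}  c v = sym (ι0·v≡0 v)
  sumV-ι· {d = suc d} c v = begin
    (ι (c Fin.zero) · v) ⊕ sumV (λ i → ι (c (Fin.suc i)) · v) ≡⟨ cong ((ι (c Fin.zero) · v) ⊕_) (sumV-ι· (c ∘ Fin.suc) v) ⟩
    (ι (c Fin.zero) · v) ⊕ (ι (sum (c ∘ Fin.suc)) · v)         ≡⟨ ·-distribʳ _ _ v ⟨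
    (ι (c Fin.zero) + ι (sum (c ∘ Fin.suc))) · v              ≡⟨ cong (_· v) (ι-+ _ _) ⟨
    ι (sum c) · v                                             ∎

  sumV-punchIn : ∀ {n m} (p : Fin (suc m)) (f : Fin (suc m) → Vec Carrier n) → sumV f ≡ f p ⊕ sumV (f ∘ punchIn p)
  sumV-punchIn Fin.zero f = refl
  sumV-punchIn {m = suc m} (Fin.suc p) f = begin
    f Fin.zero ⊕ sumV (f ∘ Fin.suc)                              ≡⟨ cong (f Fin.zero ⊕_) (sumV-punchIn p (f ∘ Fin.suc)) ⟩
    f Fin.zero ⊕ (f (Fin.suc p) ⊕ sumV (f ∘ Fin.suc ∘ punchIn p)) ≡⟨ ⊕-assoc _ _ _ ⟨
    (f Fin.zero ⊕ f (Fin.suc p)) ⊕ sumV (f ∘ Fin.suc ∘ punchIn p) ≡⟨ cong (_⊕ sumV (f ∘ Fin.suc ∘ punchIn p)) (⊕-comm _ _) ⟩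
    (f (Fin.suc p) ⊕ f Fin.zero) ⊕ sumV (f ∘ Fin.suc ∘ punchIn p) ≡⟨ ⊕-assoc _ _ _ ⟩
    f (Fin.suc p) ⊕ sumV (f ∘ punchIn (Fin.suc p))               ∎

  sumV-↑ : ∀ {n} m {k} (f : Fin (m ℕ.+ k) → Vec Carrier n) → sumV f ≡ sumV (f ∘ (_↑ˡ k)) ⊕ sumV (f ∘ (m ↑ʳ_))
  sumV-↑ zero    f = sym (⊕-identityˡ _)
  sumV-↑ (suc m) f = trans (cong (f Fin.zero ⊕_) (sumV-↑ m (f ∘ Fin.suc))) (sym (⊕-assoc _ _ _))

  sumV-combine : ∀ {n} d {t} (f : Fin (d ℕ.* t) → Vec Carrier n) →
                 sumV f ≡ sumV {d = d} (λ i → sumV {d = t} (λ j → f (combine i j)))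
  sumV-combine zero    f = refl
  sumV-combine (suc d) {t} f =
    trans (sumV-↑ t f) (cong (sumV (f ∘ (_↑ˡ (d ℕ.* t))) ⊕_) (sumV-combine d (f ∘ (t ↑ʳ_))))

  lincomb-cong : ∀ {n d} {c c' : Fin d → K.Carrier} (b : Fin d → Vec Carrier n) →
                 (∀ i → c i ≡ c' i) → lincomb ι c b ≡ lincomb ι c' b
  lincomb-cong b c≗c' = sumV-cong (λ i → cong (λ a → ι a · b i) (c≗c' i))

  lincomb-zero : ∀ {n d} (b : Fin d → Vec Carrier n) → lincomb ι (λ _ → K.0#) b ≡ 0v
  lincomb-zero b = sumV-zero _ (ι0·v≡0 ∘ b)

  lincomb-+ : ∀ {n d} (c c' : Fin d → K.Carrier) (b : Fin d → Vec Carrier n) →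
              lincomb ι (λ i → c i K.+ c' i) b ≡ lincomb ι c b ⊕ lincomb ι c' b
  lincomb-+ c c' b = trans (sumV-cong (λ i → trans (cong (_· b i) (ι-+ _ _)) (·-distribʳ _ _ (b i))))
                           (sumV-⊕ (λ i → ι (c i) · b i) (λ i → ι (c' i) · b i))

  lincomb-* : ∀ {n d} a (c : Fin d → K.Carrier) (b : Fin d → Vec Carrier n) →
              lincomb ι (λ i → a K.* c i) b ≡ ι a · lincomb ι c b
  lincomb-* a c b = trans (sumV-cong (λ i → trans (cong (_· b i) (ι-* _ _)) (·-assoc _ _ (b i))))
                          (sym (sumV-· (ι a) (λ i → ι (c i) · b i)))

  lincomb-neg : ∀ {n d} (c : Fin d → K.Carrier) (b : Fin d → Vec Carrier n) →
                lincomb ι (λ i → K.- c i) b ≡ ⊖ lincomb ι c b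
  lincomb-neg c b = trans (sumV-cong (λ i → trans (cong (_· b i) (ι-neg (c i))) (-·-⊖ (ι (c i)) (b i))))
                          (sym (sumV-· (- 1#) (λ i → ι (c i) · b i)))

  lincomb-· : ∀ {n d} a (c : Fin d → K.Carrier) (b : Fin d → Vec Carrier n) →
              lincomb ι c (λ i → a · b i) ≡ a · lincomb ι c b
  lincomb-· a c b = trans (sumV-cong (λ i → ·-comm (ι (c i)) a (b i))) (sym (sumV-· a (λ i → ι (c i) · b i)))

  lincomb-tail : ∀ {n d} (c : Fin (suc d) → K.Carrier) (b : Fin (suc d) → Vec Carrier n) →
                 c Fin.zero ≡ K.0# → lincomb ι c b ≡ lincomb ι (c ∘ Fin.suc) (b ∘ Fin.suc)
  lincomb-tail c b c₀≡0 =
    trans (cong (λ a → (ι a · b Fin.zero) ⊕ rest) c₀≡0) (trans (cong (_⊕ rest) (ι0·v≡0 _)) (⊕-identityˡ rest))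
    where rest = lincomb ι (c ∘ Fin.suc) (b ∘ Fin.suc)

  lincomb-∈ : ∀ {n d} {U : Vec Carrier n → Set} → IsSubspace ι U →
              (c : Fin d → K.Carrier) (b : Fin d → Vec Carrier n) → (∀ i → U (b i)) → U (lincomb ι c b)
  lincomb-∈ {d = zero}  U-sub c b b∈U = IsSubspace.0∈ U-sub
  lincomb-∈ {d = suc d} U-sub c b b∈U = IsSubspace.+∈ U-sub (IsSubspace.·∈ U-sub (c Fin.zero) (b∈U Fin.zero))
    (lincomb-∈ U-sub (c ∘ Fin.suc) (b ∘ Fin.suc) (b∈U ∘ Fin.suc))

  lincomb-insertAt : ∀ {n m} (p : Fin (suc m)) (x : Fin (suc m) → Vec Carrier n) (κ c : Fin m → K.Carrier) →
    lincomb ι (insertAt c p (sum (λ i → c i K.* κ i))) x ≡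
    lincomb ι c (λ i → x (punchIn p i) ⊕ (ι (κ i) · x p))
  lincomb-insertAt p x κ c = begin
    lincomb ι c′ x
      ≡⟨ sumV-punchIn p (λ j → ι (c′ j) · x j) ⟩
    (ι (c′ p) · x p) ⊕ sumV (λ i → ι (c′ (punchIn p i)) · x (punchIn p i))
      ≡⟨ cong₂ (λ a s → (ι a · x p) ⊕ s) (insertAt-lookup c p σ)
               (sumV-cong (λ i → cong (λ a → ι a · x (punchIn p i)) (insertAt-punchIn c p σ i))) ⟩
    (ι σ · x p) ⊕ lincomb ι c (x ∘ punchIn p)
      ≡⟨ cong (_⊕ lincomb ι c (x ∘ punchIn p)) (sumV-ι· (λ i → c i K.* κ i) (x p)) ⟨
    sumV (λ i → ι (c i K.* κ i) · x p) ⊕ lincomb ι c (x ∘ punchIn p)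
      ≡⟨ cong (_⊕ lincomb ι c (x ∘ punchIn p)) (sumV-cong (λ i → trans (cong (_· x p) (ι-* (c i) (κ i))) (·-assoc _ _ (x p)))) ⟩
    sumV (λ i → ι (c i) · (ι (κ i) · x p)) ⊕ lincomb ι c (x ∘ punchIn p)
      ≡⟨ ⊕-comm _ _ ⟩
    lincomb ι c (x ∘ punchIn p) ⊕ sumV (λ i → ι (c i) · (ι (κ i) · x p))
      ≡⟨ sumV-⊕ (λ i → ι (c i) · x (punchIn p i)) (λ i → ι (c i) · (ι (κ i) · x p)) ⟨
    sumV (λ i → (ι (c i) · x (punchIn p i)) ⊕ (ι (c i) · (ι (κ i) · x p)))
      ≡⟨ sumV-cong (λ i → ·-distribˡ (ι (c i)) (x (punchIn p i)) (ι (κ i) · x p)) ⟨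
    lincomb ι c (λ i → x (punchIn p i) ⊕ (ι (κ i) · x p)) ∎
    where
    σ = sum (λ i → c i K.* κ i)
    c′ = insertAt c p σ

  Span : ∀ {n d} → (Fin d → Vec Carrier n) → Vec Carrier n → Set
  Span {d = d} b u = Σ (Fin d → K.Carrier) (λ c → lincomb ι c b ≡ u)

  Independent : ∀ {n d} → (Fin d → Vec Carrier n) → Set
  Independent b = ∀ c → lincomb ι c b ≡ 0v → ∀ i → c i ≡ K.0#

  Dependent : ∀ {n m} → (Fin m → Vec Carrier n) → Set
  Dependent {m = m} x = Σ (Fin m → K.Carrier) (λ c → lincomb ι c x ≡ 0v × ∃ λ j → c j ≢ K.0#)

  lincomb-injective : ∀ {n d} {b : Fin d → Vec Carrier n} → Independent b →
                      ∀ c c′ → lincomb ι c b ≡ lincomb ι c′ b → ∀ i → c i ≡ c′ i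
  lincomb-injective {b = b} b-ind c c′ eq i = K.x∙y⁻¹≈ε⇒x≈y (c i) (c′ i) (b-ind (λ i → c i K.+ K.- c′ i) (begin
    lincomb ι (λ i → c i K.+ K.- c′ i) b         ≡⟨ lincomb-+ c (λ i → K.- c′ i) b ⟩
    lincomb ι c b ⊕ lincomb ι (λ i → K.- c′ i) b ≡⟨ cong₂ _⊕_ eq (lincomb-neg c′ b) ⟩
    lincomb ι c′ b ⊕ (⊖ lincomb ι c′ b)          ≡⟨ ⊕-inverseʳ _ ⟩
    0v                                           ∎) i)

  restrict-IsSubspace : ∀ {n} {U : Vec Carrier n → Set} → IsSubspace (λ a → a) U → IsSubspace ι U
  restrict-IsSubspace U-sub = record { 0∈ = 0∈ ; +∈ = +∈ ; ·∈ = λ a → ·∈ (ι a) }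
    where open IsSubspace U-sub

  ⊖∈ : ∀ {n} {U : Vec Carrier n → Set} → IsSubspace ι U → ∀ {v} → U v → U (⊖ v)
  ⊖∈ {U = U} U-sub {v} v∈U =
    subst (λ a → U (a · v)) (trans (ι-neg K.1#) (cong -_ ι-1)) (IsSubspace.·∈ U-sub (K.- K.1#) v∈U)

  lincomb-++ : ∀ {n a b} (c : Fin (a ℕ.+ b) → K.Carrier) (x : Fin a → Vec Carrier n) (y : Fin b → Vec Carrier n) →
               lincomb ι c (x ++ y) ≡ lincomb ι (c ∘ (_↑ˡ b)) x ⊕ lincomb ι (c ∘ (a ↑ʳ_)) y
  lincomb-++ {a = a} {b} c x y = trans (sumV-↑ a (λ k → ι (c k) · (x ++ y) k)) (cong₂ _⊕_
    (sumV-cong (λ i → cong (ι (c (i ↑ˡ b)) ·_) (lookup-++ˡ x y i)))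
    (sumV-cong (λ i → cong (ι (c (a ↑ʳ i)) ·_) (lookup-++ʳ x y i))))

  module _ {n : ℕ} {U : Vec Carrier n → Set} {a : Carrier} where

    IsSubspace-∘· : IsSubspace ι U → IsSubspace ι (λ v → U (a · v))
    IsSubspace-∘· U-sub = record
      { 0∈ = subst U (sym (·-zeroʳ a)) 0∈
      ; +∈ = λ u∈ v∈ → subst U (sym (·-distribˡ a _ _)) (+∈ u∈ v∈)
      ; ·∈ = λ c {v} v∈ → subst U (·-comm (ι c) a v) (·∈ c v∈)
      }
      where open IsSubspace U-sub

    HasDim-∘· : ∀ {d} (a≢0 : a ≢ 0#) → HasDim ι U d → HasDim ι (λ v → U (a · v)) d
    HasDim-∘· a≢0 U-dim = record
      { basis = λ i → a ⁻¹⟨ a≢0 ⟩ · basis i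
      ; inU   = λ i → subst U (sym (·-cancelʳ a a≢0 (basis i))) (inU i)
      ; indep = λ c rel → indep c (a·v≡0⇒v≡0 (⁻¹≢0 a a≢0) (trans (sym (lincomb-· _ c basis)) rel))
      ; spans = λ {v} av∈U → proj₁ (spans av∈U) ,
          trans (lincomb-· _ _ basis) (trans (cong (a ⁻¹⟨ a≢0 ⟩ ·_) (proj₂ (spans av∈U))) (·-cancelˡ a a≢0 v))
      }
      where open HasDim U-dim

  Span-⊆ : ∀ {n d} {U : Vec Carrier n → Set} → IsSubspace ι U →
           (b : Fin d → Vec Carrier n) → (∀ i → U (b i)) → ∀ {u} → Span b u → U u
  Span-⊆ U-sub b b∈U (c , refl) = lincomb-∈ U-sub c b b∈U

  Span-⊕· : ∀ {n d} {b : Fin d → Vec Carrier n} {u v} → Span b u → Span b v → ∀ k → Span b (u ⊕ (ι k · v))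
  Span-⊕· {b = b} (c , c≡u) (c′ , c′≡v) k =
    (λ i → c i K.+ k K.* c′ i) ,
    trans (lincomb-+ c _ b)
          (trans (cong (lincomb ι c b ⊕_) (lincomb-* k c′ b)) (cong₂ (λ u v → u ⊕ (ι k · v)) c≡u c′≡v))

  relation⇒Span : ∀ {n d} {u : Vec Carrier n} {x : Fin d → Vec Carrier n} (c : Fin (suc d) → K.Carrier) →
                  lincomb ι c (u ∷ x) ≡ 0v → c Fin.zero ≢ K.0# → Span x u
  relation⇒Span {u = u} {x} c rel c₀≢0 = (λ i → K.- c₀⁻¹ K.* c (Fin.suc i)) , (begin
    lincomb ι (λ i → K.- c₀⁻¹ K.* c (Fin.suc i)) x  ≡⟨ lincomb-* (K.- c₀⁻¹) (c ∘ Fin.suc) x ⟩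
    ι (K.- c₀⁻¹) · L                               ≡⟨ cong (_· L) (ι-neg c₀⁻¹) ⟩
    (- ι c₀⁻¹) · L                                 ≡⟨ -·-⊖ (ι c₀⁻¹) L ⟩
    ⊖ (ι c₀⁻¹ · L)                                 ≡⟨ ·-comm (- 1#) (ι c₀⁻¹) L ⟩
    ι c₀⁻¹ · (⊖ L)                                 ≡⟨ cong (ι c₀⁻¹ ·_) c₀u≡⊖L ⟨
    ι c₀⁻¹ · (ι (c Fin.zero) · u)                  ≡⟨ ·-assoc _ _ u ⟨
    (ι c₀⁻¹ * ι (c Fin.zero)) · u                  ≡⟨ cong (_· u) (ι-⁻¹ (c Fin.zero) c₀≢0) ⟩
    1# · u                                         ≡⟨ ·-identityˡ u ⟩
    u                                              ∎)
    where
    c₀⁻¹ = c Fin.zero K.⁻¹⟨ c₀≢0 ⟩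
    L = lincomb ι (c ∘ Fin.suc) x
    c₀u≡⊖L : ι (c Fin.zero) · u ≡ ⊖ L
    c₀u≡⊖L = ⊕-inverseʳ-unique L _ (trans (⊕-comm L _) rel)

  HasDim⇒Independent : ∀ {n d} {U : Vec Carrier n → Set} (U-dim : HasDim ι U d) → Independent (HasDim.basis U-dim)
  HasDim⇒Independent U-dim c rel i = ι≡0⇒≡0 (HasDim.indep U-dim c rel i)

  Independent⇒HasDim : ∀ {n d} {U : Vec Carrier n → Set} (b : Fin d → Vec Carrier n) →
                       (∀ i → U (b i)) → Independent b → (∀ {u} → U u → Span b u) → HasDim ι U d
  Independent⇒HasDim b b∈U b-ind b-spans = record
    { basis = b ; inU = b∈U ; indep = λ c rel i → trans (cong ι (b-ind c rel i)) ι-0 ; spans = b-spans }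

  zero-head-relation : ∀ {n d} (b : Fin (suc d) → Vec Carrier n) → b Fin.zero ≡ 0v →
                       lincomb ι (K.1# ∷ λ _ → K.0#) b ≡ 0v
  zero-head-relation b b₀≡0 =
    trans (cong₂ _⊕_ (trans (cong (ι K.1# ·_) b₀≡0) (·-zeroʳ _)) (lincomb-zero (b ∘ Fin.suc))) (⊕-identityˡ 0v)

  Independent⇒head≢0 : ∀ {n d} {b : Fin (suc d) → Vec Carrier n} → Independent b → b Fin.zero ≢ 0v
  Independent⇒head≢0 {b = b} b-ind b₀≡0 = K.1≢0 (b-ind (K.1# ∷ λ _ → K.0#) (zero-head-relation b b₀≡0) Fin.zero)

  trivial-relation : ∀ {n d} {u : Vec Carrier n} {x : Fin d → Vec Carrier n} → Independent x →
                     ∀ c → lincomb ι c (u ∷ x) ≡ 0v → c Fin.zero ≡ K.0# → ∀ i → c i ≡ K.0#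
  trivial-relation {u = u} {x} x-ind c rel c₀≡0 Fin.zero    = c₀≡0
  trivial-relation {u = u} {x} x-ind c rel c₀≡0 (Fin.suc i) =
    x-ind (c ∘ Fin.suc) (trans (sym (lincomb-tail c (u ∷ x) c₀≡0)) rel) i

  module Exchange (_≟_ : DecidableEquality K.Carrier) where

    Independent-∷ : ∀ {n d} {u : Vec Carrier n} {x : Fin d → Vec Carrier n} →
                    Independent x → ¬ Span x u → Independent (u ∷ x)
    Independent-∷ x-ind u∉ c rel with c Fin.zero ≟ K.0#
    ... | yes c₀≡0 = trivial-relation x-ind c rel c₀≡0
    ... | no  c₀≢0 = ⊥-elim (u∉ (relation⇒Span c rel c₀≢0))

    span-dependent : ∀ {n} d {m} → d < m → (b : Fin d → Vec Carrier n) (x : Fin m → Vec Carrier n) →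
                     (∀ j → Span b (x j)) → Dependent x
    span-dependent zero {suc m} _ b x x∈ =
      (K.1# ∷ λ _ → K.0#) , zero-head-relation x (sym (proj₂ (x∈ Fin.zero))) , Fin.zero , K.1≢0
    span-dependent (suc d) {suc m} (s≤s d<m) b x x∈ = choose (Fin.any? (λ j → ¬? (a j Fin.zero ≟ K.0#)))
      where
      a : Fin (suc m) → Fin (suc d) → K.Carrier
      a j = proj₁ (x∈ j)

      pivot : ∀ p → a p Fin.zero ≢ K.0# → Dependent x
      pivot p α≢0 = insertAt c p _ , trans (lincomb-insertAt p x κ c) rel , punchIn p j , cj′≢0
        where
        κ : Fin m → K.Carrier
        κ i = K.- (a (punchIn p i) Fin.zero K.* a p Fin.zero K.⁻¹⟨ α≢0 ⟩)
        y : Fin m → Vec _ _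
        y i = x (punchIn p i) ⊕ (ι (κ i) · x p)
        y∈ : ∀ i → Span (b ∘ Fin.suc) (y i)
        y∈ i = proj₁ s ∘ Fin.suc , trans (sym (lincomb-tail (proj₁ s) b (K.x+[-x/y]*y≡0 _ _ α≢0))) (proj₂ s)
          where s = Span-⊕· {b = b} (x∈ (punchIn p i)) (x∈ p) (κ i)
        dep = span-dependent d d<m (b ∘ Fin.suc) y y∈
        c = proj₁ dep
        rel = proj₁ (proj₂ dep)
        j = proj₁ (proj₂ (proj₂ dep))
        cj′≢0 = subst (_≢ K.0#) (sym (insertAt-punchIn c p _ j)) (proj₂ (proj₂ (proj₂ dep)))

      choose : Dec (∃ λ j → a j Fin.zero ≢ K.0#) → Dependent x
      choose (yes (p , α≢0)) = pivot p α≢0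
      choose (no none) = span-dependent d (ℕₚ.m<n⇒m<1+n d<m) (b ∘ Fin.suc) x λ j →
        a j ∘ Fin.suc ,
        trans (sym (lincomb-tail (a j) b (decidable-stable (a j Fin.zero ≟ K.0#) (λ ne → none (j , ne)))))
              (proj₂ (x∈ j))

    independent⇒≤ : ∀ {n d m} (b : Fin d → Vec Carrier n) (x : Fin m → Vec Carrier n) →
                    (∀ j → Span b (x j)) → Independent x → m ≤ d
    independent⇒≤ {d = d} {m} b x x∈ x-ind with m ≤? d
    ... | yes m≤d = m≤d
    ... | no  m≰d with span-dependent d (ℕₚ.≰⇒> m≰d) b x x∈
    ...   | c , rel , j , cj≢0 = ⊥-elim (cj≢0 (x-ind c rel j))

    independent⇒spans : ∀ {n d} (b x : Fin d → Vec Carrier n) → (∀ j → Span b (x j)) → Independent x →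
                        ∀ {u} → Span b u → Span x u
    independent⇒spans {d = d} b x x∈ x-ind {u} u∈
      with span-dependent d (ℕₚ.n<1+n d) b (u ∷ x) (λ { Fin.zero → u∈ ; (Fin.suc j) → x∈ j })
    ... | c , rel , j , cj≢0 with c Fin.zero ≟ K.0#
    ...   | yes c₀≡0 = ⊥-elim (cj≢0 (trivial-relation x-ind c rel c₀≡0 j))
    ...   | no  c₀≢0 = relation⇒Span c rel c₀≢0

    module _ {n d : ℕ} {U : Vec Carrier n → Set} (U-dim : HasDim ι U d) where
      private
        b = HasDim.basis U-dim

      independent-≤-dim : ∀ {m} (x : Fin m → Vec Carrier n) → (∀ j → U (x j)) → Independent x → m ≤ d
      independent-≤-dim x x∈U = independent⇒≤ b x (λ j → HasDim.spans U-dim (x∈U j))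

      independent-spans-dim : (x : Fin d → Vec Carrier n) → (∀ j → U (x j)) → Independent x →
                              ∀ {u} → U u → Span x u
      independent-spans-dim x x∈U x-ind u∈U =
        independent⇒spans b x (λ j → HasDim.spans U-dim (x∈U j)) x-ind (HasDim.spans U-dim u∈U)

      HasDim-⊆⇒⊇ : ∀ {W : Vec Carrier n → Set} → IsSubspace ι W → HasDim ι W d → (∀ {v} → W v → U v) →
                   ∀ {v} → U v → W v
      HasDim-⊆⇒⊇ W-sub W-dim W⊆U v∈U = Span-⊆ W-sub bW (HasDim.inU W-dim)
        (independent-spans-dim bW (W⊆U ∘ HasDim.inU W-dim) (HasDim⇒Independent W-dim) v∈U)
        where bW = HasDim.basis W-dim

    Independent-[_] : ∀ {n} {u : Vec Carrier n} → u ≢ 0v → Independent (u ∷ [])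
    Independent-[ u≢0 ] = Independent-∷ {x = []} (λ _ _ ()) (λ (_ , 0≡u) → u≢0 (sym 0≡u))

    ι·∈⇒≡0 : ∀ {n} {H : Vec Carrier n → Set} {u} → IsSubspace ι H → ¬ H u → ∀ a → H (ι a · u) → a ≡ K.0#
    ι·∈⇒≡0 {H = H} {u} H-sub u∉H a au∈H with a ≟ K.0#
    ... | yes a≡0 = a≡0
    ... | no  a≢0 = ⊥-elim (u∉H (subst H u≡ (IsSubspace.·∈ H-sub (a K.⁻¹⟨ a≢0 ⟩) au∈H)))
      where
      u≡ : ι (a K.⁻¹⟨ a≢0 ⟩) · (ι a · u) ≡ u
      u≡ = trans (sym (·-assoc _ _ u)) (trans (cong (_· u) (ι-⁻¹ a a≢0)) (·-identityˡ u))

    opaque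
      ∃-outside : ∀ {n d} {U H : Vec Carrier n → Set} → HasDim ι U d → IsSubspace ι H → (∀ v → Dec (H v)) →
                  ¬ (∀ {v} → U v → H v) → ∃ λ u → U u × ¬ H u
      ∃-outside {U = U} {H} U-dim H-sub H? U⊈H with Fin.any? (λ j → ¬? (H? (HasDim.basis U-dim j)))
      ... | yes (j , bⱼ∉H) = HasDim.basis U-dim j , HasDim.inU U-dim j , bⱼ∉H
      ... | no  none = ⊥-elim (U⊈H (λ v∈U → Span-⊆ H-sub (HasDim.basis U-dim)
              (λ j → decidable-stable (H? (HasDim.basis U-dim j)) (λ bⱼ∉H → none (j , bⱼ∉H)))
              (HasDim.spans U-dim v∈U)))

    opaque
      hyperplane-split : ∀ {n d} {U W : Vec Carrier n → Set} {w} → HasDim ι U (suc d) →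
                         IsSubspace ι W → HasDim ι W d → (∀ {v} → W v → U v) → U w → ¬ W w →
                         ∀ {u} → U u → ∃ λ a → ∃ λ l → W l × u ≡ (ι a · w) ⊕ l
      hyperplane-split {n} {d} {U} {W} {w} U-dim W-sub W-dim W⊆U w∈U w∉W {u} u∈U =
        c Fin.zero , lincomb ι (c ∘ Fin.suc) b , lincomb-∈ W-sub _ b (HasDim.inU W-dim) , sym (proj₂ span)
        where
        b : Fin d → Vec Carrier n
        b = HasDim.basis W-dim
        w∷b∈U : ∀ j → U ((w ∷ b) j)
        w∷b∈U Fin.zero    = w∈U
        w∷b∈U (Fin.suc i) = W⊆U (HasDim.inU W-dim i)
        span : Span (w ∷ b) u
        span = independent-spans-dim U-dim (w ∷ b) w∷b∈U
                 (Independent-∷ (HasDim⇒Independent W-dim) (w∉W ∘ Span-⊆ W-sub b (HasDim.inU W-dim))) u∈U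
        c : Fin (suc d) → K.Carrier
        c = proj₁ span

    independent-spans-section : ∀ {n m} {U H : Vec Carrier n → Set} {u} → HasDim ι U (suc m) → IsSubspace ι H →
                                U u → ¬ H u → (y : Fin m → Vec Carrier n) → (∀ i → U (y i)) → (∀ i → H (y i)) →
                                Independent y → ∀ {v} → U v × H v → Span y v
    independent-spans-section {U = U} {H} {u} U-dim H-sub u∈U u∉H y y∈U y∈H y-ind {v} (v∈U , v∈H) =
      c ∘ Fin.suc , trans (sym (lincomb-tail c (u ∷ y) c₀≡0)) (proj₂ span)
      where
      u∷y∈U : ∀ j → U ((u ∷ y) j)
      u∷y∈U Fin.zero    = u∈U
      u∷y∈U (Fin.suc i) = y∈U i
      span = independent-spans-dim U-dim (u ∷ y) u∷y∈U (Independent-∷ y-ind (u∉H ∘ Span-⊆ H-sub y y∈H)) v∈U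
      c = proj₁ span
      c₀u∈H : H (ι (c Fin.zero) · u)
      c₀u∈H = subst H (sym (x⊕y≡z⇒x≡z⊖y _ (lincomb ι (c ∘ Fin.suc) y) v (proj₂ span)))
                      (IsSubspace.+∈ H-sub v∈H (⊖∈ H-sub (lincomb-∈ H-sub _ y y∈H)))
      c₀≡0 = ι·∈⇒≡0 H-sub u∉H (c Fin.zero) c₀u∈H

    hyperplane-section : ∀ {n m} {U H : Vec Carrier n → Set} {u} → IsSubspace ι U → HasDim ι U (suc m) →
                         IsSubspace ι H → U u → ¬ H u →
                         (∀ {v} → U v → ∃ λ a → ∃ λ x → H x × v ≡ (ι a · u) ⊕ x) →
                         HasDim ι (λ v → U v × H v) m
    hyperplane-section {m = m} {U} {H} {u} U-sub U-dim H-sub u∈U u∉H split =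
      choose (Fin.any? (λ j → ¬? (a j ≟ K.0#)))
      where
      b = HasDim.basis U-dim
      a : Fin (suc m) → K.Carrier
      a j = proj₁ (split (HasDim.inU U-dim j))
      x : Fin (suc m) → Vec Carrier _
      x j = proj₁ (proj₂ (split (HasDim.inU U-dim j)))
      x∈H : ∀ j → H (x j)
      x∈H j = proj₁ (proj₂ (proj₂ (split (HasDim.inU U-dim j))))
      b≡ : ∀ j → b j ≡ (ι (a j) · u) ⊕ x j
      b≡ j = proj₂ (proj₂ (proj₂ (split (HasDim.inU U-dim j))))

      choose : Dec (∃ λ p → a p ≢ K.0#) → HasDim ι (λ v → U v × H v) m
      choose (no none) = ⊥-elim (u∉H (Span-⊆ H-sub b bⱼ∈H (HasDim.spans U-dim u∈U)))
        where
        bⱼ∈H : ∀ j → H (b j)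
        bⱼ∈H j = subst H (sym (trans (b≡ j) (trans (cong (_⊕ x j) (trans (cong (λ c → ι c · u) aⱼ≡0) (ι0·v≡0 u)))
                                                   (⊕-identityˡ (x j)))))
                         (x∈H j)
          where aⱼ≡0 = decidable-stable (a j ≟ K.0#) (λ aⱼ≢0 → none (j , aⱼ≢0))
      choose (yes (p , aₚ≢0)) = Independent⇒HasDim y (λ i → y∈U i , y∈H i) y-ind
                                  (independent-spans-section U-dim H-sub u∈U u∉H y y∈U y∈H y-ind)
        where
        κ : Fin m → K.Carrier
        κ i = K.- (a (punchIn p i) K.* a p K.⁻¹⟨ aₚ≢0 ⟩)
        y : Fin m → Vec Carrier _
        y i = b (punchIn p i) ⊕ (ι (κ i) · b p)

        y∈U : ∀ i → U (y i)
        y∈U i = IsSubspace.+∈ U-sub (HasDim.inU U-dim _) (IsSubspace.·∈ U-sub (κ i) (HasDim.inU U-dim p))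

        y∈H : ∀ i → H (y i)
        y∈H i = subst H (sym y≡) (IsSubspace.+∈ H-sub (x∈H (punchIn p i)) (IsSubspace.·∈ H-sub (κ i) (x∈H p)))
          where
          q = punchIn p i
          coefficient≡0 : ι (a q) + ι (κ i) * ι (a p) ≡ 0#
          coefficient≡0 = trans (cong (ι (a q) +_) (sym (ι-* (κ i) (a p))))
                                (trans (sym (ι-+ _ _)) (trans (cong ι (K.x+[-x/y]*y≡0 _ _ aₚ≢0)) ι-0))
          y≡ : y i ≡ x q ⊕ (ι (κ i) · x p)
          y≡ = begin
            b q ⊕ (ι (κ i) · b p)                                     ≡⟨ cong₂ (λ v w → v ⊕ (ι (κ i) · w)) (b≡ q) (b≡ p) ⟩
            ((ι (a q) · u) ⊕ x q) ⊕ (ι (κ i) · ((ι (a p) · u) ⊕ x p)) ≡⟨ ⊕-collect _ _ _ u (x q) (x p) ⟩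
            ((ι (a q) + ι (κ i) * ι (a p)) · u) ⊕ (x q ⊕ (ι (κ i) · x p)) ≡⟨ cong (λ c → (c · u) ⊕ (x q ⊕ (ι (κ i) · x p))) coefficient≡0 ⟩
            (0# · u) ⊕ (x q ⊕ (ι (κ i) · x p))                         ≡⟨ cong (_⊕ (x q ⊕ (ι (κ i) · x p))) (·-zeroˡ u) ⟩
            0v ⊕ (x q ⊕ (ι (κ i) · x p))                               ≡⟨ ⊕-identityˡ _ ⟩
            x q ⊕ (ι (κ i) · x p)                                      ∎

        y-ind : Independent y
        y-ind d rel i = trans (sym (insertAt-punchIn d p _ i))
          (HasDim⇒Independent U-dim (insertAt d p _) (trans (lincomb-insertAt p b κ d) rel) (punchIn p i))

    subspaces-meet : ∀ {n a b d} {U W : Vec Carrier n → Set} → IsSubspace ι U → IsSubspace ι W →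
                     HasDim ι U a → HasDim ι W b → (s : Fin d → Vec Carrier n) →
                     (∀ {v} → U v → Span s v) → (∀ {v} → W v → Span s v) → d < a ℕ.+ b →
                     ∃ λ v → v ≢ 0v × U v × W v
    subspaces-meet {a = a} {b} {d} {U} {W} U-sub W-sub U-dim W-dim s U⊆s W⊆s d<a+b = v , v≢0 , v∈U , v∈W
      where
      bU = HasDim.basis U-dim
      bW = HasDim.basis W-dim
      x∈s : ∀ k → Span s ((bU ++ bW) k)
      x∈s k with Fin.splitAt a k
      ... | inj₁ i = U⊆s (HasDim.inU U-dim i)
      ... | inj₂ j = W⊆s (HasDim.inU W-dim j)
      dep = span-dependent d d<a+b s (bU ++ bW) x∈s
      c = proj₁ dep
      v = lincomb ι (c ∘ (_↑ˡ b)) bU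
      w = lincomb ι (c ∘ (a ↑ʳ_)) bW
      v⊕w≡0 : v ⊕ w ≡ 0v
      v⊕w≡0 = trans (sym (lincomb-++ c bU bW)) (proj₁ (proj₂ dep))
      v∈U = lincomb-∈ U-sub _ bU (HasDim.inU U-dim)
      v∈W = subst W (sym (⊕-inverseʳ-unique w v (trans (⊕-comm w v) v⊕w≡0)))
                    (⊖∈ W-sub (lincomb-∈ W-sub _ bW (HasDim.inU W-dim)))
      v≢0 : v ≢ 0v
      v≢0 v≡0 = proj₂ (proj₂ (proj₂ dep)) (subst (λ k → c k ≡ K.0#) (Fin.join-splitAt a b j) (all-zero (Fin.splitAt a j)))
        where
        j = proj₁ (proj₂ (proj₂ dep))
        w≡0 : w ≡ 0v
        w≡0 = trans (sym (⊕-identityˡ w)) (trans (cong (_⊕ w) (sym v≡0)) v⊕w≡0)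
        all-zero : ∀ s → c (Fin.join a b s) ≡ K.0#
        all-zero (inj₁ i) = HasDim⇒Independent U-dim _ v≡0 i
        all-zero (inj₂ i) = HasDim⇒Independent W-dim _ w≡0 i

funToFin-cong : ∀ {m n} {f g : Fin m → Fin n} → (∀ i → f i ≡ g i) → funToFin f ≡ funToFin g
funToFin-cong {zero}  f≗g = refl
funToFin-cong {suc m} f≗g = cong₂ combine (f≗g Fin.zero) (funToFin-cong (f≗g ∘ Fin.suc))

^-cancelʳ-≤ : ∀ q {a b} → 1 < q → q ^ a ≤ q ^ b → a ≤ b
^-cancelʳ-≤ q {a} {b} 1<q qᵃ≤qᵇ with a ≤? b
... | yes a≤b = a≤b
... | no  a≰b = ⊥-elim (ℕₚ.<⇒≱ (ℕₚ.^-monoʳ-< q 1<q (ℕₚ.≰⇒> a≰b)) qᵃ≤qᵇ)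

module _ {A : Set} {n : ℕ} (A↔ : A ↔ Fin n) where
  private
    module A↔ where
      open Inverse A↔ public
      to-injective = Injection.injective (↔⇒↣ A↔)
      from-injective = Injection.injective (↔⇒↣ (↔-sym A↔))

  ↔⇒≟ : DecidableEquality A
  ↔⇒≟ = Fin.inj⇒≟ (↔⇒↣ A↔)

  any?-↔ : {P : A → Set} → Decidable P → Dec (∃ P)
  any?-↔ {P} P? = map′ (λ (i , p) → A↔.from i , p)
                       (λ (a , p) → A↔.to a , subst P (sym (A↔.strictlyInverseʳ a)) p)
                       (Fin.any? (P? ∘ A↔.from))

  -- Functions Fin d → A are enumerated by Fin (n ^ d).
  functions-any? : ∀ {d} {P : (Fin d → A) → Set} → (∀ {c c′} → (∀ i → c i ≡ c′ i) → P c → P c′) →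
                   Decidable P → Dec (∃ P)
  functions-any? {d} {P} resp P? =
    map′ (λ (i , p) → A↔.from ∘ finToFun i , p)
         (λ (c , p) → funToFin (A↔.to ∘ c) ,
                      resp (λ i → trans (sym (A↔.strictlyInverseʳ (c i)))
                                        (cong A↔.from (sym (Fin.finToFun-funToFin (A↔.to ∘ c) i)))) p)
         (Fin.any? (P? ∘ (λ i → A↔.from ∘ finToFun i)))

  module _ {B : Set} {m : ℕ} (B↔ : B ↔ Fin m) {d : ℕ} (f : (Fin d → A) → B) where
    private
      module B↔ where
        open Inverse B↔ public
        to-injective = Injection.injective (↔⇒↣ B↔)
        from-injective = Injection.injective (↔⇒↣ (↔-sym B↔))

    injective⇒^≤ : (∀ c c′ → f c ≡ f c′ → ∀ i → c i ≡ c′ i) → n ^ d ≤ m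
    injective⇒^≤ f-inj = Fin.injective⇒≤ {f = B↔.to ∘ f ∘ decode} decode-inj
      where
      decode : Fin (n ^ d) → Fin d → A
      decode i = A↔.from ∘ finToFun i
      decode-inj : ∀ {i j} → B↔.to (f (decode i)) ≡ B↔.to (f (decode j)) → i ≡ j
      decode-inj {i} {j} eq = begin
        i                                ≡⟨ Fin.funToFin-finToFin {d} {n} i ⟨
        funToFin (finToFun {n} {d} i)    ≡⟨ funToFin-cong (λ k → A↔.from-injective (f-inj _ _ (B↔.to-injective eq) k)) ⟩
        funToFin (finToFun {n} {d} j)    ≡⟨ Fin.funToFin-finToFin {d} {n} j ⟩
        j                        ∎
        where open ≡-Reasoning

    surjective⇒≤^ : (∀ {c c′} → (∀ i → c i ≡ c′ i) → f c ≡ f c′) → (∀ b → ∃ λ c → f c ≡ b) → m ≤ n ^ d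
    surjective⇒≤^ f-cong f-surj = Fin.injective⇒≤ {f = encode} encode-inj
      where
      encode : Fin m → Fin (n ^ d)
      encode i = funToFin (A↔.to ∘ proj₁ (f-surj (B↔.from i)))
      encode-inj : ∀ {i j} → encode i ≡ encode j → i ≡ j
      encode-inj {i} {j} eq = B↔.from-injective (begin
        B↔.from i   ≡⟨ proj₂ (f-surj (B↔.from i)) ⟨
        f cᵢ        ≡⟨ f-cong (λ k → A↔.to-injective (begin
                         A↔.to (cᵢ k)                    ≡⟨ Fin.finToFun-funToFin _ k ⟨
                         finToFun (encode i) k           ≡⟨ cong (λ e → finToFun e k) eq ⟩
                         finToFun (encode j) k           ≡⟨ Fin.finToFun-funToFin _ k ⟩
                         A↔.to (cⱼ k)                    ∎)) ⟩
        f cⱼ        ≡⟨ proj₂ (f-surj (B↔.from j)) ⟩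
        B↔.from j   ∎)
        where
        open ≡-Reasoning
        cᵢ = proj₁ (f-surj (B↔.from i))
        cⱼ = proj₁ (f-surj (B↔.from j))

module FieldExtension (F E : Field) (emb : Embedding F E) {q t : ℕ} (1<q : 1 < q)
                      (F↔ : Field.Carrier F ↔ Fin q) (E↔ : Field.Carrier E ↔ Fin (q ^ t)) where
  open import Data.Vec using ([]; _∷_; head)
  private module F = FieldProperties F
  open FieldProperties E
  open Vectors E
  open Combinations F E emb
  open Exchange (↔⇒≟ F↔)
  private
    open module LinAlgₙ {n} = LinAlg E n
  open ≡-Reasoning

  ≡-head : {u v : Vec Carrier 1} → head u ≡ head v → u ≡ v
  ≡-head {_ ∷ []} {_ ∷ []} = cong (_∷ [])

  head-⊕ : (u v : Vec Carrier 1) → head (u ⊕ v) ≡ head u + head v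
  head-⊕ (_ ∷ []) (_ ∷ []) = refl

  head-· : ∀ a (u : Vec Carrier 1) → head (a · u) ≡ a * head u
  head-· a (_ ∷ []) = refl

  sumV-head· : ∀ {n d} (f : Fin d → Vec Carrier 1) (v : Vec Carrier n) →
               sumV (λ j → head (f j) · v) ≡ head (sumV f) · v
  sumV-head· {d = zero}  f v = sym (·-zeroˡ v)
  sumV-head· {d = suc d} f v = begin
    (head (f Fin.zero) · v) ⊕ sumV (λ j → head (f (Fin.suc j)) · v)
      ≡⟨ cong ((head (f Fin.zero) · v) ⊕_) (sumV-head· (f ∘ Fin.suc) v) ⟩
    (head (f Fin.zero) · v) ⊕ (head (sumV (f ∘ Fin.suc)) · v)
      ≡⟨ ·-distribʳ _ _ v ⟨
    (head (f Fin.zero) + head (sumV (f ∘ Fin.suc))) · v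
      ≡⟨ cong (_· v) (head-⊕ (f Fin.zero) (sumV (f ∘ Fin.suc))) ⟨
    head (sumV f) · v ∎

  Span? : ∀ {d} (β : Fin d → Vec Carrier 1) u → Dec (Span β u)
  Span? β u = functions-any? F↔ (λ c≗c′ eq → trans (sym (lincomb-cong β c≗c′)) eq)
                                (λ c → ≡-dec (↔⇒≟ E↔) (lincomb ι c β) u)

  independent⇒≤t : ∀ {d} {β : Fin d → Vec Carrier 1} → Independent β → d ≤ t
  independent⇒≤t {β = β} β-ind = ^-cancelʳ-≤ q 1<q
    (injective⇒^≤ F↔ E↔ (λ c → head (lincomb ι c β))
                        (λ c c′ eq → lincomb-injective β-ind c c′ (≡-head eq)))

  spanning⇒t≤ : ∀ {d} {β : Fin d → Vec Carrier 1} → (∀ u → Span β u) → t ≤ d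
  spanning⇒t≤ {β = β} β-spans = ^-cancelʳ-≤ q 1<q
    (surjective⇒≤^ F↔ E↔ (λ c → head (lincomb ι c β))
                         (λ c≗c′ → cong head (lincomb-cong β c≗c′))
                         (λ a → proj₁ (β-spans (a ∷ [])) , cong head (proj₂ (β-spans (a ∷ [])))))

  grow : ∀ n → (∃ λ d → Σ (Fin d → Vec Carrier 1) λ β → Independent β × (∀ u → Span β u))
             ⊎ Σ (Fin n → Vec Carrier 1) Independent
  grow zero = inj₂ ((λ ()) , λ c _ ())
  grow (suc n) with grow n
  ... | inj₁ basis = inj₁ basis
  ... | inj₂ (β , β-ind) with any?-↔ E↔ (λ a → ¬? (Span? β (a ∷ [])))
  ...   | yes (a , a∉) = inj₂ ((a ∷ []) Vector.∷ β , Independent-∷ β-ind a∉)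
  ...   | no  none     = inj₁ (n , β , β-ind , λ { (a ∷ []) → decidable-stable (Span? β (a ∷ [])) (λ a∉ → none (a , a∉)) })

  dim-over-subfield : HasDim ι (λ (_ : Vec Carrier 1) → ⊤) t
  dim-over-subfield with grow (suc t)
  ... | inj₂ (β , β-ind) = ⊥-elim (ℕₚ.1+n≰n (independent⇒≤t {β = β} β-ind))
  ... | inj₁ (d , β , β-ind , β-spans) =
    subst (HasDim ι _) (ℕₚ.≤-antisym (independent⇒≤t {β = β} β-ind) (spanning⇒t≤ β-spans))
          (Independent⇒HasDim β (λ _ → tt) β-ind (λ {u} _ → β-spans u))

  module RestrictScalars {n d : ℕ} {U : Vec Carrier n → Set} (U-sub : IsSubspace (λ a → a) U)
                         (U-dim : HasDim (λ a → a) U d) where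
    private
      e = HasDim.basis U-dim
      β = HasDim.basis dim-over-subfield

    γ : Fin (d ℕ.* t) → Vec Carrier n
    γ k = head (β (remainder {d} t k)) · e (quotient {d} t k)

    γ∈U : ∀ k → U (γ k)
    γ∈U k = IsSubspace.·∈ U-sub _ (HasDim.inU U-dim _)

    γ-combine : ∀ i j → γ (combine i j) ≡ head (β j) · e i
    γ-combine i j = cong (λ (i , j) → head (β j) · e i) (Fin.remQuot-combine i j)

    scalar : (Fin (d ℕ.* t) → F.Carrier) → Fin d → Carrier
    scalar c i = head (lincomb ι (λ j → c (combine i j)) β)

    lincomb-γ : ∀ c → lincomb ι c γ ≡ lincomb (λ a → a) (scalar c) e
    lincomb-γ c = trans (sumV-combine d (λ k → ι (c k) · γ k)) (sumV-cong λ i → begin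
      sumV (λ j → ι (c (combine i j)) · γ (combine i j))
        ≡⟨ sumV-cong (λ j → cong (ι (c (combine i j)) ·_) (γ-combine i j)) ⟩
      sumV (λ j → ι (c (combine i j)) · (head (β j) · e i))
        ≡⟨ sumV-cong (λ j → trans (sym (·-assoc _ _ (e i))) (cong (_· e i) (sym (head-· _ (β j))))) ⟩
      sumV (λ j → head (ι (c (combine i j)) · β j) · e i)
        ≡⟨ sumV-head· (λ j → ι (c (combine i j)) · β j) (e i) ⟩
      scalar c i · e i ∎)

    γ-ind : Independent γ
    γ-ind c rel k = subst (λ k → c k ≡ F.0#) (Fin.combine-remQuot {d} t k) (cᵢⱼ≡0 (quotient t k) (remainder {d} t k))
      where
      cᵢⱼ≡0 : ∀ i j → c (combine i j) ≡ F.0#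
      cᵢⱼ≡0 i j = HasDim⇒Independent dim-over-subfield (λ j → c (combine i j))
                    (≡-head (HasDim.indep U-dim (scalar c) (trans (sym (lincomb-γ c)) rel) i)) j

    γ-spans : ∀ {u} → U u → Span γ u
    γ-spans {u} u∈U = c , (begin
      lincomb ι c γ                        ≡⟨ lincomb-γ c ⟩
      lincomb (λ a → a) (scalar c) e       ≡⟨ sumV-cong (λ i → cong (_· e i) (scalar-c≡a i)) ⟩
      lincomb (λ a → a) a e                ≡⟨ proj₂ (HasDim.spans U-dim u∈U) ⟩
      u                                    ∎)
      where
      a = proj₁ (HasDim.spans U-dim u∈U)
      cᵢ : Fin d → Fin t → F.Carrier
      cᵢ i = proj₁ (HasDim.spans dim-over-subfield {a i ∷ []} tt)
      c : Fin (d ℕ.* t) → F.Carrier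
      c k = cᵢ (quotient t k) (remainder {d} t k)
      scalar-c≡a : ∀ i → scalar c i ≡ a i
      scalar-c≡a i = cong head (trans
        (lincomb-cong β (λ j → cong (λ (i , j) → cᵢ i j) (Fin.remQuot-combine i j)))
        (proj₂ (HasDim.spans dim-over-subfield {a i ∷ []} tt)))

  restrict-HasDim : ∀ {n d} {U : Vec Carrier n → Set} → IsSubspace (λ a → a) U → HasDim (λ a → a) U d →
                    HasDim ι U (d ℕ.* t)
  restrict-HasDim U-sub U-dim = Independent⇒HasDim γ γ∈U γ-ind γ-spans
    where open RestrictScalars U-sub U-dim

module Coordinates (E : Field) where
  open import Data.Vec using (_∷_; tabulate; lookup)
  open import Data.Vec.Properties using (lookup∘tabulate; tabulate∘lookup; lookup-replicate)
  open FieldProperties E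
  open Vectors E
  private open module LinAlgₙ {n} = LinAlg E n
  open ≡-Reasoning

  unit : ∀ {n} → Fin n → Vec Carrier n
  unit Fin.zero    = 1# ∷ 0v
  unit (Fin.suc i) = 0# ∷ unit i

  sumV-0∷ : ∀ {n d} (a : Fin d → Carrier) (v : Fin d → Vec Carrier n) →
            sumV (λ i → a i · (0# ∷ v i)) ≡ 0# ∷ sumV (λ i → a i · v i)
  sumV-0∷ {d = zero}  a v = refl
  sumV-0∷ {d = suc d} a v =
    trans (cong ((a Fin.zero · (0# ∷ v Fin.zero)) ⊕_) (sumV-0∷ (a ∘ Fin.suc) (v ∘ Fin.suc)))
          (cong (_∷ ((a Fin.zero · v Fin.zero) ⊕ sumV (λ i → a (Fin.suc i) · v (Fin.suc i)))) (trans (+-identityʳ _) (zeroʳ (a Fin.zero))))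

  lincomb-unit : ∀ {n} (c : Fin n → Carrier) → lincomb (λ a → a) c unit ≡ tabulate c
  lincomb-unit {zero}  c = refl
  lincomb-unit {suc n} c = begin
    (c₀ · (1# ∷ 0v)) ⊕ sumV (λ i → c (Fin.suc i) · (0# ∷ unit i))
      ≡⟨ cong ((c₀ · (1# ∷ 0v)) ⊕_) (sumV-0∷ (c ∘ Fin.suc) unit) ⟩
    (c₀ * 1# + 0#) ∷ ((c₀ · 0v) ⊕ L)
      ≡⟨ cong₂ _∷_ (trans (+-identityʳ _) (*-identityʳ c₀))
                   (trans (cong (_⊕ L) (·-zeroʳ c₀)) (trans (⊕-identityˡ L) (lincomb-unit (c ∘ Fin.suc)))) ⟩
    tabulate c ∎
    where
    c₀ = c Fin.zero
    L = lincomb (λ a → a) (c ∘ Fin.suc) unit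

  Eⁿ-dim : ∀ {n} → HasDim (λ a → a) (λ (_ : Vec Carrier n) → ⊤) n
  Eⁿ-dim = record
    { basis = unit
    ; inU   = λ _ → tt
    ; indep = λ c rel i → begin
        c i                            ≡⟨ lookup∘tabulate c i ⟨
        lookup (tabulate c) i          ≡⟨ cong (λ v → lookup v i) (trans (sym (lincomb-unit c)) rel) ⟩
        lookup 0v i                    ≡⟨ lookup-replicate i 0# ⟩
        0#                             ∎
    ; spans = λ {u} _ → lookup u , trans (lincomb-unit (lookup u)) (tabulate∘lookup u)
    }

module ProjectivePlane (E : Field) {m : ℕ} (E↔ : Field.Carrier E ↔ Fin m) where
  open FieldProperties E
  open Vectors E
  open Combinations E E (idEmbedding E)
  open Exchange (↔⇒≟ E↔)
  open Coordinates E
  open LinAlg E 3 using (V; 0v; _·_; _⊕_; IsSubspace; HasDim)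

  module TwoLines {ℓ ℓ′ : V → Set} (ℓ-sub : IsSubspace (λ a → a) ℓ) (ℓ-dim : HasDim (λ a → a) ℓ 2)
           (ℓ′-sub : IsSubspace (λ a → a) ℓ′) (ℓ′-dim : HasDim (λ a → a) ℓ′ 2) where

    opaque
      lines-meet : ∃ λ p → p ≢ 0v × ℓ p × ℓ′ p
      lines-meet = subspaces-meet ℓ-sub ℓ′-sub ℓ-dim ℓ′-dim unit
        (λ _ → HasDim.spans Eⁿ-dim tt) (λ _ → HasDim.spans Eⁿ-dim tt) ℕₚ.≤-refl

    opaque
      lines-meet-in-point : ¬ (∀ v → ℓ v ⇔ ℓ′ v) → ∀ {p} → p ≢ 0v → ℓ p → ℓ′ p →
                            ∀ {v} → ℓ v → ℓ′ v → ∃ λ a → v ≡ a · p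
      lines-meet-in-point ℓ≢ℓ′ {p} p≢0 p∈ℓ p∈ℓ′ {v} v∈ℓ v∈ℓ′
        with any?-↔ E↔ (λ a → ≡-dec (↔⇒≟ E↔) v (a · p))
      ... | yes found = found
      ... | no  ∄a    = ⊥-elim (ℓ≢ℓ′ (λ u → mk⇔ (ℓ⊆ℓ′ u) (HasDim-⊆⇒⊇ ℓ′-dim ℓ-sub ℓ-dim (ℓ⊆ℓ′ _))))
        where
        v∷p : Fin 2 → V
        v∷p = v Vector.∷ p Vector.∷ Vector.[]
        v∷p-ind : Independent v∷p
        v∷p-ind = Independent-∷ {x = p Vector.∷ Vector.[]} Independent-[ p≢0 ] λ (c , c₀p≡v) →
          ∄a (c Fin.zero , sym (trans (sym (⊕-identityʳ _)) c₀p≡v))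
        v∷p∈ : ∀ {U : V → Set} → U v → U p → ∀ j → U (v∷p j)
        v∷p∈ v∈U p∈U Fin.zero = v∈U
        v∷p∈ v∈U p∈U (Fin.suc Fin.zero) = p∈U
        ℓ⊆ℓ′ : ∀ u → ℓ u → ℓ′ u
        ℓ⊆ℓ′ u u∈ℓ = Span-⊆ ℓ′-sub v∷p (v∷p∈ v∈ℓ′ p∈ℓ′)
                       (independent-spans-dim ℓ-dim v∷p (v∷p∈ v∈ℓ p∈ℓ) v∷p-ind u∈ℓ)

module PointImages (F E : Field) (emb : Embedding F E) {q t : ℕ} (1<q : 1 < q)
                   (F↔ : Field.Carrier F ↔ Fin q) (E↔ : Field.Carrier E ↔ Fin (q ^ t))
                   (ℓ∞ : LinAlg.V E 3 → Set) (ℓ∞-line : Setting.IsLine F E emb ℓ∞)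
                   (μ : LinAlg.V E 3 → Set) (μ-sub : Setting.IsFSubspace F E emb μ)
                   (μ-dim : Setting.HasDimF F E emb μ (2 ℕ.* t ℕ.+ 1)) (ℓ∞⊆μ : ∀ v → ℓ∞ v → μ v) where
  open import Data.Vec.Functional using (_∷_)
  open FieldProperties E
  open Vectors E
  open Setting F E emb
  open Combinations F E emb
  open Exchange (↔⇒≟ F↔)
  open FieldExtension F E emb {t = t} 1<q F↔ E↔ using (restrict-HasDim)
  private
    module Eˣ = Combinations.Exchange E E (idEmbedding E) (↔⇒≟ E↔)
    _≟_ : DecidableEquality Carrier
    _≟_ = ↔⇒≟ E↔
  open ≡-Reasoning

  ℓ∞-sub : IsESubspace ℓ∞
  ℓ∞-sub = proj₁ ℓ∞-line

  ℓ∞-dimF : HasDimF ℓ∞ (2 ℕ.* t)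
  ℓ∞-dimF = restrict-HasDim ℓ∞-sub (proj₂ ℓ∞-line)

  2t+1≡1+2t : 2 ℕ.* t ℕ.+ 1 ≡ suc (2 ℕ.* t)
  2t+1≡1+2t = ℕₚ.+-comm (2 ℕ.* t) 1

  opaque
    μ-meets-point : ∀ {w} → ¬ ℓ∞ w → ∃ λ a → a ≢ 0# × μ (a · w)
    μ-meets-point {w} w∉ℓ∞ = choose (Fin.any? (λ k → ¬? (a k ≟ 0#)))
      where
      m : Fin (2 ℕ.* t ℕ.+ 1) → V
      m = HasDim.basis μ-dim
      split : ∀ k → ∃ λ a → ∃ λ l → ℓ∞ l × m k ≡ (a · w) ⊕ l
      split k = Eˣ.hyperplane-split (Coordinates.Eⁿ-dim E) ℓ∞-sub (proj₂ ℓ∞-line) (λ _ → tt) tt w∉ℓ∞ tt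
      a : Fin (2 ℕ.* t ℕ.+ 1) → Carrier
      a k = proj₁ (split k)
      l : Fin (2 ℕ.* t ℕ.+ 1) → V
      l k = proj₁ (proj₂ (split k))
      l∈ℓ∞ : ∀ k → ℓ∞ (l k)
      l∈ℓ∞ k = proj₁ (proj₂ (proj₂ (split k)))
      m≡ : ∀ k → m k ≡ (a k · w) ⊕ l k
      m≡ k = proj₂ (proj₂ (proj₂ (split k)))

      choose : Dec (∃ λ k → a k ≢ 0#) → ∃ λ a → a ≢ 0# × μ (a · w)
      choose (yes (k , aₖ≢0)) = a k , aₖ≢0 ,
        subst μ (sym (x⊕y≡z⇒x≡z⊖y _ (l k) (m k) (sym (m≡ k))))
              (IsSubspace.+∈ μ-sub (HasDim.inU μ-dim k) (⊖∈ μ-sub (ℓ∞⊆μ _ (l∈ℓ∞ k))))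
      choose (no none) = ⊥-elim (ℕₚ.1+n≰n (subst (ℕ._≤ 2 ℕ.* t) 2t+1≡1+2t
        (independent-≤-dim ℓ∞-dimF m mₖ∈ℓ∞ (HasDim⇒Independent μ-dim))))
        where
        mₖ∈ℓ∞ : ∀ k → ℓ∞ (m k)
        mₖ∈ℓ∞ k = subst ℓ∞ (sym (trans (m≡ k) (trans (cong (λ c → (c · w) ⊕ l k) aₖ≡0)
                                                     (trans (cong (_⊕ l k) (·-zeroˡ w)) (⊕-identityˡ (l k))))))
                           (l∈ℓ∞ k)
          where
          aₖ≡0 : a k ≡ 0#
          aₖ≡0 = decidable-stable (a k ≟ 0#) (λ aₖ≢0 → none (k , aₖ≢0))

  -- Otherwise a·w, b·w and an F-basis of ℓ∞ would be 2t + 2 independent vectors of μ.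
  opaque
    μ-meets-point-once : ∀ {w} → ¬ ℓ∞ w → ∀ {a b} → a ≢ 0# → μ (a · w) → μ (b · w) → ∃ λ c → b ≡ ι c * a
    μ-meets-point-once {w} w∉ℓ∞ {a} {b} a≢0 aw∈μ bw∈μ with any?-↔ F↔ (λ c → b ≟ (ι c * a))
    ... | yes found = found
    ... | no  ∄c    = ⊥-elim (ℕₚ.1+n≰n (subst (suc (suc (2 ℕ.* t)) ℕ.≤_) 2t+1≡1+2t
                        (independent-≤-dim μ-dim x x∈μ x-ind)))
      where
      γ : Fin (2 ℕ.* t) → V
      γ = HasDim.basis ℓ∞-dimF
      γ∈ℓ∞ : ∀ k → ℓ∞ (γ k)
      γ∈ℓ∞ = HasDim.inU ℓ∞-dimF
      ℓ∞F-sub : IsFSubspace ℓ∞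
      ℓ∞F-sub = restrict-IsSubspace ℓ∞-sub

      x : Fin (suc (suc (2 ℕ.* t))) → V
      x = (b · w) ∷ (a · w) ∷ γ
      x∈μ : ∀ j → μ (x j)
      x∈μ Fin.zero = bw∈μ
      x∈μ (Fin.suc Fin.zero) = aw∈μ
      x∈μ (Fin.suc (Fin.suc k)) = ℓ∞⊆μ _ (γ∈ℓ∞ k)

      aw∉ℓ∞ : ¬ ℓ∞ (a · w)
      aw∉ℓ∞ aw∈ℓ∞ = w∉ℓ∞ (subst ℓ∞ (·-cancelˡ a a≢0 w) (IsSubspace.·∈ ℓ∞-sub (a ⁻¹⟨ a≢0 ⟩) aw∈ℓ∞))

      bw∉span : ¬ Span ((a · w) ∷ γ) (b · w)
      bw∉span (c , rel) = ∄c (c Fin.zero , x∙y⁻¹≈ε⇒x≈y b _ (Eˣ.ι·∈⇒≡0 ℓ∞-sub w∉ℓ∞ _ [b-ca]w∈ℓ∞))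
        where
        ca·w : V
        ca·w = ι (c Fin.zero) · (a · w)
        L : V
        L = lincomb ι (c ∘ Fin.suc) γ
        [b-ca]w∈ℓ∞ : ℓ∞ ((b + - (ι (c Fin.zero) * a)) · w)
        [b-ca]w∈ℓ∞ = subst ℓ∞ (begin
          L                                         ≡⟨ x⊕y≡z⇒x≡z⊖y L ca·w (b · w) (trans (⊕-comm L ca·w) rel) ⟩
          (b · w) ⊕ (⊖ ca·w)                        ≡⟨ cong (λ v → (b · w) ⊕ (⊖ v)) (·-assoc _ a w) ⟨
          (b · w) ⊕ (⊖ ((ι (c Fin.zero) * a) · w))  ≡⟨ cong ((b · w) ⊕_) (-·-⊖ _ w) ⟨
          (b · w) ⊕ ((- (ι (c Fin.zero) * a)) · w)  ≡⟨ ·-distribʳ b _ w ⟨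
          (b + - (ι (c Fin.zero) * a)) · w          ∎)
          (lincomb-∈ ℓ∞F-sub _ γ γ∈ℓ∞)

      x-ind : Independent x
      x-ind = Independent-∷ {x = (a · w) ∷ γ} (Independent-∷ (HasDim⇒Independent ℓ∞-dimF)
                                           (aw∉ℓ∞ ∘ Span-⊆ ℓ∞F-sub γ γ∈ℓ∞))
                            bw∉span

module AndreBruckBose (F E : Field) (emb : Embedding F E) {q t : ℕ} (1<q : 1 < q)
    (F↔ : Field.Carrier F ↔ Fin q) (E↔ : Field.Carrier E ↔ Fin (q ^ t))
    (ℓ∞ : LinAlg.V E 3 → Set) (ℓ∞-line : Setting.IsLine F E emb ℓ∞)
    (μ : LinAlg.V E 3 → Set) (μ-sub : Setting.IsFSubspace F E emb μ)
    (μ-dim : Setting.HasDimF F E emb μ (2 ℕ.* t ℕ.+ 1)) (ℓ∞⊆μ : ∀ v → ℓ∞ v → μ v)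
    (ℓ : LinAlg.V E 3 → Set) (ℓ-line : Setting.IsLine F E emb ℓ) (ℓ≢ℓ∞ : ¬ (∀ v → ℓ v ⇔ ℓ∞ v)) where
  open import Data.Vec.Functional using ([]; _∷_)
  open FieldProperties E
  open Vectors E
  open Setting F E emb
  open Combinations F E emb
  open Exchange (↔⇒≟ F↔)
  open PointImages F E emb {t = t} 1<q F↔ E↔ ℓ∞ ℓ∞-line μ μ-sub μ-dim ℓ∞⊆μ
  private
    module Eˡ = Combinations E E (idEmbedding E)
    module Eˣ = Eˡ.Exchange (↔⇒≟ E↔)
    open ProjectivePlane.TwoLines E E↔ (proj₁ ℓ-line) (proj₂ ℓ-line) (proj₁ ℓ∞-line) (proj₂ ℓ∞-line)
  open ≡-Reasoning

  ℓ-sub : IsESubspace ℓ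
  ℓ-sub = proj₁ ℓ-line

  p∞ : V
  p∞ = proj₁ lines-meet

  p∞≢0 : p∞ ≢ 0v
  p∞≢0 = proj₁ (proj₂ lines-meet)

  p∞∈π∞ : π∞ ℓ ℓ∞ p∞
  p∞∈π∞ = proj₂ (proj₂ lines-meet)

  π∞-sub : IsESubspace (π∞ ℓ ℓ∞)
  π∞-sub = ∩-IsSubspace ℓ-sub ℓ∞-sub

  π∞F-sub : IsFSubspace (π∞ ℓ ℓ∞)
  π∞F-sub = restrict-IsSubspace π∞-sub

  InF-coefficient≢0 : ∀ {w u} → ((a , _) : InF w u) → u ≢ 0v → a ≢ 0#
  InF-coefficient≢0 {w} (a , u≡aw) u≢0 a≡0 = u≢0 (trans u≡aw (trans (cong (_· w) a≡0) (·-zeroˡ w)))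

  π∞⇒InF-p∞ : ∀ {v} → π∞ ℓ ℓ∞ v → InF p∞ v
  π∞⇒InF-p∞ (v∈ℓ , v∈ℓ∞) = lines-meet-in-point ℓ≢ℓ∞ p∞≢0 (proj₁ p∞∈π∞) (proj₂ p∞∈π∞) v∈ℓ v∈ℓ∞

  InF⇒π∞ : ∀ {w u} → π∞ ℓ ℓ∞ w → InF w u → π∞ ℓ ℓ∞ u
  InF⇒π∞ w∈π∞ (a , refl) = IsSubspace.·∈ π∞-sub a w∈π∞

  π∞⇒InF : ∀ {w u} → w ≢ 0v → π∞ ℓ ℓ∞ w → π∞ ℓ ℓ∞ u → InF w u
  π∞⇒InF {w} {u} w≢0 w∈π∞ u∈π∞ = a * b ⁻¹⟨ b≢0 ⟩ , (begin
    u                                   ≡⟨ u≡ap∞ ⟩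
    a · p∞                              ≡⟨ cong (a ·_) (·-cancelˡ b b≢0 p∞) ⟨
    a · (b ⁻¹⟨ b≢0 ⟩ · (b · p∞))         ≡⟨ cong (λ v → a · (b ⁻¹⟨ b≢0 ⟩ · v)) w≡bp∞ ⟨
    a · (b ⁻¹⟨ b≢0 ⟩ · w)                ≡⟨ ·-assoc _ _ w ⟨
    (a * b ⁻¹⟨ b≢0 ⟩) · w                ∎)
    where
    a = proj₁ (π∞⇒InF-p∞ u∈π∞)
    u≡ap∞ = proj₂ (π∞⇒InF-p∞ u∈π∞)
    b = proj₁ (π∞⇒InF-p∞ w∈π∞)
    w≡bp∞ = proj₂ (π∞⇒InF-p∞ w∈π∞)
    b≢0 = InF-coefficient≢0 (b , w≡bp∞) w≢0

  π∞? : ∀ v → Dec (π∞ ℓ ℓ∞ v)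
  π∞? v = map′ (λ (a , v≡ap∞) → subst (π∞ ℓ ℓ∞) (sym v≡ap∞) (IsSubspace.·∈ π∞-sub a p∞∈π∞)) π∞⇒InF-p∞
               (any?-↔ E↔ (λ a → ≡-dec (↔⇒≟ E↔) v (a · p∞)))

  π∞-dim : HasDimE (π∞ ℓ ℓ∞) 1
  π∞-dim = Eˡ.Independent⇒HasDim (p∞ ∷ []) (λ { Fin.zero → p∞∈π∞ }) Eˣ.Independent-[ p∞≢0 ]
    λ v∈π∞ → (λ _ → proj₁ (π∞⇒InF-p∞ v∈π∞)) , trans (⊕-identityʳ _) (sym (proj₂ (π∞⇒InF-p∞ v∈π∞)))

  InF-sub : ∀ w → IsESubspace (InF w)
  InF-sub w = record
    { 0∈ = 0# , sym (·-zeroˡ w)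
    ; +∈ = λ (a , u≡aw) (b , v≡bw) → a + b , trans (cong₂ _⊕_ u≡aw v≡bw) (sym (·-distribʳ a b w))
    ; ·∈ = λ c (a , u≡aw) → c * a , trans (cong (c ·_) u≡aw) (sym (·-assoc c a w))
    }

  ∉π∞⇒∉ℓ∞ : ∀ {w} → ℓ w → ¬ π∞ ℓ ℓ∞ w → ¬ ℓ∞ w
  ∉π∞⇒∉ℓ∞ w∈ℓ w∉π∞ w∈ℓ∞ = w∉π∞ (w∈ℓ , w∈ℓ∞)

  ∉π∞-InF : ∀ {w u} → ((a , _) : InF w u) → a ≢ 0# → ¬ π∞ ℓ ℓ∞ u → ¬ π∞ ℓ ℓ∞ w
  ∉π∞-InF {w} (a , refl) a≢0 u∉π∞ w∈π∞ = u∉π∞ (IsSubspace.·∈ π∞-sub a w∈π∞)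

  ∉π∞-InF⁻¹ : ∀ {w u} → ((a , _) : InF w u) → a ≢ 0# → ¬ π∞ ℓ ℓ∞ w → ¬ π∞ ℓ ℓ∞ u
  ∉π∞-InF⁻¹ {w} (a , refl) a≢0 w∉π∞ u∈π∞ = w∉π∞ (subst (π∞ ℓ ℓ∞) (·-cancelˡ a a≢0 w) (IsSubspace.·∈ π∞-sub _ u∈π∞))

  module ClubToAffine {k : ℕ} {S π : V → Set} (head∈S : ∀ w → nonzero w → P∞ ℓ ℓ∞ w → S w)
                      (π-sub : IsFSubspace π) (π-dim : HasDimF π (suc k)) (π⊆ℓ : ∀ u → π u → ℓ u)
                      (π-linear : IsLinearSetOf ℓ π S)
                      (weights : ∀ w → S w → (P∞ ℓ ℓ∞ w → HasWeight π w k) × (¬ P∞ ℓ ℓ∞ w → HasWeight π w 1))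
                      where

    π∩Fp∞ : V → Set
    π∩Fp∞ u = InF p∞ u × π u

    π∩Fp∞-dim : HasDimF π∩Fp∞ k
    π∩Fp∞-dim = proj₁ (weights p∞ (head∈S p∞ p∞≢0 p∞∈π∞)) p∞∈π∞

    π⊈π∞ : ¬ (∀ {v} → π v → π∞ ℓ ℓ∞ v)
    π⊈π∞ π⊆π∞ = ℕₚ.1+n≰n (independent-≤-dim π∩Fp∞-dim (HasDim.basis π-dim)
      (λ i → π∞⇒InF-p∞ (π⊆π∞ (HasDim.inU π-dim i)) , HasDim.inU π-dim i) (HasDim⇒Independent π-dim))

    u-data : ∃ λ u → π u × ¬ π∞ ℓ ℓ∞ u
    u-data = ∃-outside π-dim π∞F-sub π∞? π⊈π∞

    u : V
    u = proj₁ u-data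

    u∉π∞ : ¬ π∞ ℓ ℓ∞ u
    u∉π∞ = proj₂ (proj₂ u-data)

    ρ-data : ∃ λ ρ → ρ ≢ 0# × μ (ρ · u)
    ρ-data = μ-meets-point (∉π∞⇒∉ℓ∞ (π⊆ℓ u (proj₁ (proj₂ u-data))) u∉π∞)

    ρ : Carrier
    ρ = proj₁ ρ-data

    ρ≢0 : ρ ≢ 0#
    ρ≢0 = proj₁ (proj₂ ρ-data)

    -- π = F·u ⊕ (π ∩ π∞), and both ρ·u and ℓ∞ lie in μ.
    ρπ⊆μ : ∀ {v} → π v → μ (ρ · v)
    ρπ⊆μ v∈π with hyperplane-split π-dim (∩-IsSubspace (restrict-IsSubspace (InF-sub p∞)) π-sub) π∩Fp∞-dim proj₂
                                   (proj₁ (proj₂ u-data)) (λ (u∈Fp∞ , _) → u∉π∞ (InF⇒π∞ p∞∈π∞ u∈Fp∞)) v∈π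
    ... | c , x , (x∈Fp∞ , _) , refl = subst μ (sym (trans (·-distribˡ ρ _ x) (cong (_⊕ (ρ · x)) (·-comm ρ (ι c) u))))
      (IsSubspace.+∈ μ-sub (IsSubspace.·∈ μ-sub c (proj₂ (proj₂ ρ-data)))
                           (ℓ∞⊆μ _ (IsSubspace.·∈ ℓ∞-sub ρ (proj₂ (InF⇒π∞ p∞∈π∞ x∈Fp∞)))))

    W : V → Set
    W v = π (ρ ⁻¹⟨ ρ≢0 ⟩ · v)

    W⊆Π : ∀ v → W v → Π ℓ μ v
    W⊆Π v v∈W = subst ℓ (·-cancelʳ ρ ρ≢0 v) (IsSubspace.·∈ ℓ-sub ρ (π⊆ℓ _ v∈W)) ,
                subst μ (·-cancelʳ ρ ρ≢0 v) (ρπ⊆μ v∈W)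

    W⊈π∞ : ¬ (∀ v → W v → π∞ ℓ ℓ∞ v)
    W⊈π∞ W⊆π∞ = ∉π∞-InF⁻¹ (ρ , refl) ρ≢0 u∉π∞
      (W⊆π∞ (ρ · u) (subst π (sym (·-cancelˡ ρ ρ≢0 u)) (proj₁ (proj₂ u-data))))

    φ⇒W : ∀ {v} → PhiImage ℓ ℓ∞ μ S v → W v × ¬ π∞ ℓ ℓ∞ v
    φ⇒W {v} (v≢0 , w , w∈S , w∉π∞ , (α , v≡αw) , v∈μ) with Equivalence.to (π-linear w) w∈S
    ... | _ , w∈ℓ , u′ , u′≢0 , u′∈π , β , u′≡βw =
      subst π ρ⁻¹v≡ (IsSubspace.·∈ π-sub (proj₁ fit) u′∈π) ,
      ∉π∞-InF⁻¹ (α , v≡αw) (InF-coefficient≢0 (α , v≡αw) v≢0) w∉π∞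
      where
      ρu′≡ : ρ · u′ ≡ (ρ * β) · w
      ρu′≡ = trans (cong (ρ ·_) u′≡βw) (sym (·-assoc ρ β w))
      fit : ∃ λ f → α ≡ ι f * (ρ * β)
      fit = μ-meets-point-once (∉π∞⇒∉ℓ∞ w∈ℓ w∉π∞) (x*y≢0 ρ≢0 (InF-coefficient≢0 (β , u′≡βw) u′≢0))
                               (subst μ ρu′≡ (ρπ⊆μ u′∈π)) (subst μ v≡αw v∈μ)
      ρ⁻¹v≡ : ι (proj₁ fit) · u′ ≡ ρ ⁻¹⟨ ρ≢0 ⟩ · v
      ρ⁻¹v≡ = begin
        ι f · u′                                ≡⟨ cong (ι f ·_) (·-cancelˡ ρ ρ≢0 u′) ⟨
        ι f · (ρ ⁻¹⟨ ρ≢0 ⟩ · (ρ · u′))           ≡⟨ ·-comm (ι f) _ _ ⟩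
        ρ ⁻¹⟨ ρ≢0 ⟩ · (ι f · (ρ · u′))           ≡⟨ cong (ρ ⁻¹⟨ ρ≢0 ⟩ ·_) (trans (cong (ι f ·_) ρu′≡) (sym (·-assoc _ _ w))) ⟩
        ρ ⁻¹⟨ ρ≢0 ⟩ · ((ι f * (ρ * β)) · w)      ≡⟨ cong (λ a → ρ ⁻¹⟨ ρ≢0 ⟩ · (a · w)) (proj₂ fit) ⟨
        ρ ⁻¹⟨ ρ≢0 ⟩ · (α · w)                    ≡⟨ cong (ρ ⁻¹⟨ ρ≢0 ⟩ ·_) v≡αw ⟨
        ρ ⁻¹⟨ ρ≢0 ⟩ · v                          ∎
        where f = proj₁ fit

    W⇒φ : ∀ {v} → W v × ¬ π∞ ℓ ℓ∞ v → PhiImage ℓ ℓ∞ μ S v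
    W⇒φ {v} (v∈W , v∉π∞) = v≢0 , y , y∈S , ∉π∞-InF (ρ , v≡ρy) ρ≢0 v∉π∞ , (ρ , v≡ρy) , proj₂ (W⊆Π v v∈W)
      where
      y : V
      y = ρ ⁻¹⟨ ρ≢0 ⟩ · v
      v≡ρy : v ≡ ρ · y
      v≡ρy = sym (·-cancelʳ ρ ρ≢0 v)
      v≢0 : v ≢ 0v
      v≢0 refl = v∉π∞ (IsSubspace.0∈ π∞-sub)
      y≢0 : y ≢ 0v
      y≢0 = a·v≢0 (⁻¹≢0 ρ ρ≢0) v≢0
      y∈S : S y
      y∈S = Equivalence.from (π-linear y) (y≢0 , π⊆ℓ y v∈W , y , y≢0 , v∈W , 1# , sym (·-identityˡ y))

  club⇒affine : ∀ {k S} → (∀ w → nonzero w → P∞ ℓ ℓ∞ w → S w) → IsLinearClub ℓ (P∞ ℓ ℓ∞) S (suc k) →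
                IsAffineSubspace (Π ℓ μ) (π∞ ℓ ℓ∞) (suc k) (PhiImage ℓ ℓ∞ μ S)
  club⇒affine head∈S (π , π-sub , π-dim , π⊆ℓ , π-linear , weights) =
    W , IsSubspace-∘· π-sub , HasDim-∘· (⁻¹≢0 ρ ρ≢0) π-dim , W⊆Π , W⊈π∞ , λ v → mk⇔ φ⇒W W⇒φ
    where open ClubToAffine head∈S π-sub π-dim π⊆ℓ π-linear weights

  module AffineToClub {k : ℕ} {S W : V → Set} (S-points : PointSetOn ℓ S)
                      (head∈S : ∀ w → nonzero w → P∞ ℓ ℓ∞ w → S w)
                      (W-sub : IsFSubspace W) (W-dim : HasDimF W (suc (suc k))) (W⊆Π : ∀ v → W v → Π ℓ μ v)
                      (W⊈π∞ : ¬ (∀ v → W v → π∞ ℓ ℓ∞ v))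
                      (W-affine : ∀ v → PhiImage ℓ ℓ∞ μ S v ⇔ (W v × ¬ π∞ ℓ ℓ∞ v)) where

    S⊆ℓ : ∀ w → S w → nonzero w × ℓ w
    S⊆ℓ = proj₁ S-points

    u-data : ∃ λ u → W u × ¬ π∞ ℓ ℓ∞ u
    u-data = ∃-outside W-dim π∞F-sub π∞? (λ W⊆π∞ → W⊈π∞ (λ v → W⊆π∞))

    u : V
    u = proj₁ u-data

    u∈W : W u
    u∈W = proj₁ (proj₂ u-data)

    u∉π∞ : ¬ π∞ ℓ ℓ∞ u
    u∉π∞ = proj₂ (proj₂ u-data)

    -- ℓ = E·u ⊕ π∞, and the E-coefficient of a vector of W ⊆ μ lies in F.
    split : ∀ {v} → W v → ∃ λ c → ∃ λ x → π∞ ℓ ℓ∞ x × v ≡ (ι c · u) ⊕ x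
    split {v} v∈W with Eˣ.hyperplane-split (proj₂ ℓ-line) π∞-sub π∞-dim proj₁ (proj₁ (W⊆Π u u∈W)) u∉π∞
                                           (proj₁ (W⊆Π v v∈W))
    ... | a , x , x∈π∞ , v≡au⊕x = proj₁ fit , x , x∈π∞ , trans v≡au⊕x (cong (λ a → (a · u) ⊕ x) a≡ιc)
      where
      au∈μ : μ (a · u)
      au∈μ = subst μ (sym (x⊕y≡z⇒x≡z⊖y (a · u) x v (sym v≡au⊕x)))
                   (IsSubspace.+∈ μ-sub (proj₂ (W⊆Π v v∈W)) (⊖∈ μ-sub (ℓ∞⊆μ x (proj₂ x∈π∞))))
      fit : ∃ λ c → a ≡ ι c * 1#
      fit = μ-meets-point-once (∉π∞⇒∉ℓ∞ (proj₁ (W⊆Π u u∈W)) u∉π∞) 1≢0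
                               (subst μ (sym (·-identityˡ u)) (proj₂ (W⊆Π u u∈W))) au∈μ
      a≡ιc : a ≡ ι (proj₁ fit)
      a≡ιc = trans (proj₂ fit) (*-identityʳ _)

    section-dim : HasDimF (λ v → W v × π∞ ℓ ℓ∞ v) (suc k)
    section-dim = hyperplane-section W-sub W-dim π∞F-sub u∈W u∉π∞ split

    z : V
    z = HasDim.basis section-dim Fin.zero

    z≢0 : z ≢ 0v
    z≢0 = Independent⇒head≢0 {b = HasDim.basis section-dim} (HasDim⇒Independent section-dim)

    module OffHead {w : V} (w∈S : S w) (w∉π∞ : ¬ π∞ ℓ ℓ∞ w) where

      w∉ℓ∞ : ¬ ℓ∞ w
      w∉ℓ∞ = ∉π∞⇒∉ℓ∞ (proj₂ (S⊆ℓ w w∈S)) w∉π∞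

      ρ-data : ∃ λ ρ → ρ ≢ 0# × μ (ρ · w)
      ρ-data = μ-meets-point w∉ℓ∞

      ρ : Carrier
      ρ = proj₁ ρ-data

      ρ≢0 : ρ ≢ 0#
      ρ≢0 = proj₁ (proj₂ ρ-data)

      ρw≢0 : ρ · w ≢ 0v
      ρw≢0 = a·v≢0 ρ≢0 (proj₁ (S⊆ℓ w w∈S))

      ρw∈W : W (ρ · w)
      ρw∈W = proj₁ (Equivalence.to (W-affine (ρ · w)) (ρw≢0 , w , w∈S , w∉π∞ , (ρ , refl) , proj₂ (proj₂ ρ-data)))

      weight-1 : HasWeight W w 1
      weight-1 = Independent⇒HasDim ((ρ · w) ∷ []) (λ { Fin.zero → (ρ , refl) , ρw∈W }) Independent-[ ρw≢0 ]
        λ { {v} ((a , v≡aw) , v∈W) → (λ _ → proj₁ (fit v≡aw v∈W)) , (begin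
              (ι (proj₁ (fit v≡aw v∈W)) · (ρ · w)) ⊕ 0v ≡⟨ ⊕-identityʳ _ ⟩
              ι (proj₁ (fit v≡aw v∈W)) · (ρ · w)        ≡⟨ ·-assoc _ ρ w ⟨
              (ι (proj₁ (fit v≡aw v∈W)) * ρ) · w        ≡⟨ cong (_· w) (proj₂ (fit v≡aw v∈W)) ⟨
              a · w                                      ≡⟨ v≡aw ⟨
              v                                          ∎) }
        where
        fit : ∀ {v a} → v ≡ a · w → W v → ∃ λ c → a ≡ ι c * ρ
        fit v≡aw v∈W = μ-meets-point-once w∉ℓ∞ ρ≢0 (proj₂ (proj₂ ρ-data)) (subst μ v≡aw (proj₂ (W⊆Π _ v∈W)))

    S⇒linear : ∀ {w} → S w → nonzero w × ℓ w × Σ V (λ u → nonzero u × W u × InF w u)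
    S⇒linear {w} w∈S with π∞? w
    ... | yes w∈π∞ = proj₁ (S⊆ℓ w w∈S) , proj₂ (S⊆ℓ w w∈S) , z , z≢0 , proj₁ (HasDim.inU section-dim Fin.zero) ,
                     π∞⇒InF (proj₁ (S⊆ℓ w w∈S)) w∈π∞ (proj₂ (HasDim.inU section-dim Fin.zero))
    ... | no  w∉π∞ = proj₁ (S⊆ℓ w w∈S) , proj₂ (S⊆ℓ w w∈S) , ρ · w , ρw≢0 , ρw∈W , (ρ , refl)
      where open OffHead w∈S w∉π∞

    linear⇒S : ∀ {w} → nonzero w × ℓ w × Σ V (λ u → nonzero u × W u × InF w u) → S w
    linear⇒S {w} (w≢0 , w∈ℓ , u′ , u′≢0 , u′∈W , a , u′≡aw) with π∞? w
    ... | yes w∈π∞ = head∈S w w≢0 w∈π∞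
    ... | no  w∉π∞
      with Equivalence.from (W-affine u′) (u′∈W , ∉π∞-InF⁻¹ (a , u′≡aw) (InF-coefficient≢0 (a , u′≡aw) u′≢0) w∉π∞)
    ...   | _ , w′ , w′∈S , _ , (a′ , u′≡a′w′) , _ =
      subst S w≡ (proj₂ S-points (a ⁻¹⟨ a≢0 ⟩ * a′) w′ (x*y≢0 (⁻¹≢0 a a≢0) (InF-coefficient≢0 (a′ , u′≡a′w′) u′≢0)) w′∈S)
      where
      a≢0 : a ≢ 0#
      a≢0 = InF-coefficient≢0 (a , u′≡aw) u′≢0
      w≡ : (a ⁻¹⟨ a≢0 ⟩ * a′) · w′ ≡ w
      w≡ = begin
        (a ⁻¹⟨ a≢0 ⟩ * a′) · w′   ≡⟨ ·-assoc _ _ w′ ⟩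
        a ⁻¹⟨ a≢0 ⟩ · (a′ · w′)   ≡⟨ cong (a ⁻¹⟨ a≢0 ⟩ ·_) (trans (sym u′≡a′w′) u′≡aw) ⟩
        a ⁻¹⟨ a≢0 ⟩ · (a · w)     ≡⟨ ·-cancelˡ a a≢0 w ⟩
        w                         ∎

    head-weight : ∀ {w} → S w → P∞ ℓ ℓ∞ w → HasWeight W w (suc k)
    head-weight {w} w∈S w∈π∞ = HasDim-⇔
      (λ v → mk⇔ (λ (v∈W , v∈π∞) → π∞⇒InF (proj₁ (S⊆ℓ w w∈S)) w∈π∞ v∈π∞ , v∈W)
                 (λ (v∈Fw , v∈W) → v∈W , InF⇒π∞ w∈π∞ v∈Fw))
      section-dim

  affine⇒club : ∀ {k S} → PointSetOn ℓ S → (∀ w → nonzero w → P∞ ℓ ℓ∞ w → S w) →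
                IsAffineSubspace (Π ℓ μ) (π∞ ℓ ℓ∞) (suc (suc k)) (PhiImage ℓ ℓ∞ μ S) →
                IsLinearClub ℓ (P∞ ℓ ℓ∞) S (suc (suc k))
  affine⇒club S-points head∈S (W , W-sub , W-dim , W⊆Π , W⊈π∞ , W-affine) =
    W , W-sub , W-dim , (λ v v∈W → proj₁ (W⊆Π v v∈W)) , (λ w → mk⇔ S⇒linear linear⇒S) ,
    λ w w∈S → head-weight w∈S , OffHead.weight-1 w∈S
    where open AffineToClub S-points head∈S W-sub W-dim W⊆Π W⊈π∞ W-affine

-- Imported only here, since the modules above open the field operations _+_ and _*_.
open import Data.Nat using (_≥_; _+_; _*_)

proposition3p3 :
    (q t k : ℕ) → q ≥ 3 → t ≥ 2 → k ≥ 2 →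
    (F E : Field) → Field.Carrier F ↔ Fin q → Field.Carrier E ↔ Fin (q ^ t) →
    (emb : Embedding F E) →
    let open Setting F E emb in
    (ℓ∞ : V → Set) → IsLine ℓ∞ →
    (μ : V → Set) → IsFSubspace μ → HasDimF μ (2 * t + 1) → (∀ v → ℓ∞ v → μ v) →
    (ℓ : V → Set) → IsLine ℓ → ¬ (∀ v → ℓ v ⇔ ℓ∞ v) →
    (S : V → Set) → PointSetOn ℓ S → (∀ w → nonzero w → P∞ ℓ ℓ∞ w → S w) →
    IsLinearClub ℓ (P∞ ℓ ℓ∞) S k ⇔ IsAffineSubspace (Π ℓ μ) (π∞ ℓ ℓ∞) k (PhiImage ℓ ℓ∞ μ S)
proposition3p3 q t zero q≥3 t≥2 ()
proposition3p3 q t (suc zero) q≥3 t≥2 (s≤s ())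
proposition3p3 q t (suc (suc k)) q≥3 _ _ F E F↔ E↔ emb ℓ∞ ℓ∞-line μ μ-sub μ-dim ℓ∞⊆μ ℓ ℓ-line ℓ≢ℓ∞ S S-points head∈S =
  mk⇔ (club⇒affine head∈S) (affine⇒club S-points head∈S)
  where
  open AndreBruckBose F E emb {t = t} (ℕₚ.≤-trans (ℕₚ.n≤1+n 2) q≥3) F↔ E↔ ℓ∞ ℓ∞-line μ μ-sub μ-dim ℓ∞⊆μ ℓ ℓ-line ℓ≢ℓ∞
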